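{- Let $n \geq 4$ and let $a,b$ be positive integers. Then the sequence $h=(h_0,h_1,\ldots,h_n)\in \mathbb{Z}_{>0}^{n+1}$ with $h_0=1$, $h_1=h_2=\cdots=h_{n-1}=a$ and $h_n=b$ (i.e. $h=(1,a,a,\ldots,a,b)$) is a pure $O$-sequence if and only if $b \leq a \leq 2b$.
   Context: Monomials are in finitely many indeterminates $x_1,\ldots,x_s$ (any $s$), each of degree $1$. An order ideal of monomials is a nonempty finite set $\mathcal{A}$ of monomials such that whenever $u\in\mathcal{A}$ and $v$ is a monomial dividing $u$, then $v\in\mathcal{A}$. It is pure if all its maximal elements with respect to divisibility have the same degree. Its $h$-vector is $h(\mathcal{A})=(h_0,\ldots,h_n)$ where $n=\max\{\deg u: u\in\mathcal{A}\}$ and $h_i$ is the number of elements of $\mathcal{A}$ of degree $i$. A finite sequence of positive integers is a pure $O$-sequence if it equals $h(\mathcal{A})$ for some pure order ideal of monomials $\mathcal{A}$ (in some number of variables). -}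

module Defs where

open import Data.Nat using (ℕ; zero; suc; _+_; _≤_; _<_; _⊔_; _≟_)
open import Data.Vec using (Vec; foldr)
open import Data.Vec.Relation.Binary.Pointwise.Inductive using (Pointwise)
open import Data.List using (List; []; _∷_; map; upTo; length; filter)
import Data.List as L
open import Data.List.Membership.Propositional using (_∈_)
open import Data.List.Relation.Unary.Unique.Propositional using (Unique)
open import Data.List.Relation.Unary.All using (All)
open import Data.Product using (Σ; ∃; _×_)
open import Relation.Binary.PropositionalEquality using (_≡_)
open import Relation.Unary using (Pred)
open import Relation.Nullary using (¬_)

Monomial : ℕ → Set
Monomial s = Vec ℕ s

deg : ∀ {s} → Monomial s → ℕ
deg = foldr (λ _ → ℕ) _+_ 0

_∣ₘ_ : ∀ {s} → Monomial s → Monomial s → Set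
v ∣ₘ u = Pointwise _≤_ v u

record OrderIdeal (s : ℕ) : Set where
  field
    elems    : List (Monomial s)
    unique   : Unique elems
    nonempty : ¬ (elems ≡ [])
    downward : ∀ {u v} → u ∈ elems → v ∣ₘ u → v ∈ elems
open OrderIdeal public

IsMaximal : ∀ {s} → OrderIdeal s → Monomial s → Set
IsMaximal A u = u ∈ elems A × (∀ {v} → v ∈ elems A → u ∣ₘ v → v ≡ u)

Pure : ∀ {s} → OrderIdeal s → Set
Pure A = ∀ {u v} → IsMaximal A u → IsMaximal A v → deg u ≡ deg v

maxDeg : ∀ {s} → OrderIdeal s → ℕ
maxDeg A = L.foldr _⊔_ 0 (map deg (elems A))

countDeg : ∀ {s} → OrderIdeal s → ℕ → ℕ
countDeg A i = length (filter (λ u → deg u ≟ i) (elems A))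

hVector : ∀ {s} → OrderIdeal s → List ℕ
hVector A = map (countDeg A) (upTo (suc (maxDeg A)))

PureOSequence : List ℕ → Set
PureOSequence h = All (0 <_) h × ∃ λ s → Σ (OrderIdeal s) λ A → Pure A × hVector A ≡ h

module Submission where

-- Sufficiency.  With p = a − b and q = 2b − a, the sequence (1, a, …, a, b) is the sum of p copies of
-- (1, 2, …, 2, 1) and q copies of (1, 1, …, 1), added entrywise except in degree 0.  These are the
-- h-vectors of the principal order ideals of x·y^(n−1) and of x^n, and gluing order ideals in disjoint
-- sets of variables along the monomial 1 (the wedge A ∨ B) adds h-vectors in positive degrees and
-- preserves purity.
--
-- Necessity.  Let A be pure with h-vector (1, a, …, a, b) and n ≥ 4.  Every variable x of A gets a
-- partner y with x·y ∈ A (x itself if x² ∈ A, else a squared variable of a top containing x, else a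
-- neighbour of x in the first top containing x, which is then squarefree), chosen so that the link
-- x ↦ x·y is injective.  As h₂ ≤ h₁, every quadratic monomial of A is a link.  Hence x·y ∉ A for
-- distinct x, y with x², y² ∈ A, and no top is squarefree (it has at least four variables, and their
-- six pairwise products would all be links of those four).  So every top is x^n or x^(n−1)·y.
-- Dividing each top by its variable of exponent ≥ n − 1 maps the b tops injectively to degree n − 1,
-- so b ≤ a; every monomial of degree n − 1 is t/x_j for a top t and one of its at most two
-- variables x_j, so a ≤ 2b.

open import Defs
open import Data.Empty using (⊥; ⊥-elim)
open import Data.Fin using (Fin; zero; suc)
import Data.Fin.Properties as FinP
open FinP using (any?) renaming (_≟_ to _≟ᶠ_)
open import Data.List
  using (List; []; _∷_; _++_; map; length; filter; replicate; applyUpTo; upTo; allFin; concatMap;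
         cartesianProductWith)
open import Data.List.Base using () renaming (find to findFirst)
open import Data.List.Properties
  using (length-map; length-removeAt′; length-++; map-upTo; length-applyUpTo; length-replicate; ∷-injective;
         foldr-preservesᵇ; foldr-forcesᵇ)
open import Data.List.Membership.Propositional using (_∈_; _∉_; find)
open import Data.List.Membership.Propositional.Properties
  using (∈-map⁺; ∈-map⁻; ∈-filter⁺; ∈-filter⁻; ∈-++⁺ˡ; ∈-++⁺ʳ; ∈-++⁻; ∈-upTo⁺; ∈-upTo⁻; ∈-allFin; ∈-concat⁺′;
         ∈-cartesianProductWith⁺; ∈-cartesianProductWith⁻; foldr-selective)
import Data.List.Membership.DecPropositional as DecMembership
open import Data.List.Relation.Binary.Subset.Propositional using (_⊆_)
open import Data.List.Relation.Unary.Any as Any using (here; there)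
open import Data.List.Relation.Unary.All as All using (All; []; _∷_)
import Data.List.Relation.Unary.All.Properties as All
open import Data.List.Relation.Unary.AllPairs as AllPairs using (_∷_)
open import Data.List.Relation.Unary.Unique.Propositional using (Unique)
import Data.List.Relation.Unary.Unique.Propositional.Properties as Unique
open import Data.Maybe using (just; nothing)
open import Data.Nat using (ℕ; zero; suc; _+_; _*_; _∸_; _≤_; _<_; _⊔_; z≤n; s≤s; _≤?_)
  renaming (_≟_ to _≟ℕ_)
open import Data.Nat.Properties hiding (_≟_)
open import Data.Nat.Tactic.RingSolver using (solve-∀)
open import Algebra.Properties.CommutativeSemigroup +-commutativeSemigroup using (interchange; x∙yz≈y∙xz)
open import Data.Product using (Σ; ∃; ∃₂; _×_; _,_; proj₁; proj₂)
open import Data.Sum using (_⊎_; inj₁; inj₂)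
import Data.Vec as Vec
open Vec using (Vec; []; _∷_; lookup; zipWith; splitAt; _[_]≔_)
open import Data.Vec.Properties
  using (lookup-replicate; lookup∘update; lookup∘update′; lookup-zipWith; ≡-dec; ++-injectiveˡ; ++-injectiveʳ;
         sum-++)
open import Data.Vec.Relation.Binary.Pointwise.Inductive as Pointwise using ([]; _∷_; Pointwise-≡⇒≡)
open import Data.Vec.Relation.Binary.Pointwise.Extensional using (ext; extensional⇒inductive)
open import Function using (_∘_; _∘′_; case_of_; _⇔_; mk⇔; Equivalence)
open import Level using (0ℓ)
open import Relation.Binary.Definitions using (DecidableEquality)
open import Relation.Binary.PropositionalEquality
open import Relation.Nullary using (¬_; Dec; yes; no; ¬?; contradiction)
open import Relation.Nullary.Decidable using (_×-dec_)
open import Relation.Unary using (Pred; Decidable)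

private
  variable
    r s : ℕ
    i j : Fin s
    t u v w : Monomial s

-- Counting duplicate-free lists

module _ {A : Set} where

  ∈-─ : ∀ {x y} {xs : List A} (x∈xs : x ∈ xs) → y ∈ xs → y ≢ x → y ∈ (xs Any.─ x∈xs)
  ∈-─ (here refl) (here refl)  y≢x = contradiction refl y≢x
  ∈-─ (here refl) (there y∈xs) y≢x = y∈xs
  ∈-─ (there x∈xs) (here refl) y≢x = here refl
  ∈-─ (there x∈xs) (there y∈xs) y≢x = there (∈-─ x∈xs y∈xs y≢x)

  Unique-⊆⇒length≤ : {xs ys : List A} → Unique xs → xs ⊆ ys → length xs ≤ length ys
  Unique-⊆⇒length≤ {[]} _ _ = z≤n
  Unique-⊆⇒length≤ {x ∷ xs} {ys} (x∉xs ∷ !xs) xs⊆ys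
    rewrite length-removeAt′ ys (Any.index (xs⊆ys (here refl))) =
    s≤s (Unique-⊆⇒length≤ !xs λ y∈xs →
      ∈-─ (xs⊆ys (here refl)) (xs⊆ys (there y∈xs)) λ { refl → All.lookup x∉xs y∈xs refl })

  Unique-⊆⇒length< : ∀ {y} {xs ys : List A} → Unique xs → xs ⊆ ys → y ∈ ys → y ∉ xs →
                     length xs < length ys
  Unique-⊆⇒length< {xs = xs} !xs xs⊆ys y∈ys y∉xs =
    Unique-⊆⇒length≤ {_ ∷ xs} (All.tabulate (λ { x∈xs refl → y∉xs x∈xs }) ∷ !xs)
      λ { (here refl) → y∈ys ; (there x∈xs) → xs⊆ys x∈xs }

  Unique-⊆⇒length≡ : {xs ys : List A} → Unique xs → Unique ys → xs ⊆ ys → ys ⊆ xs →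
                     length xs ≡ length ys
  Unique-⊆⇒length≡ !xs !ys xs⊆ys ys⊆xs =
    ≤-antisym (Unique-⊆⇒length≤ !xs xs⊆ys) (Unique-⊆⇒length≤ !ys ys⊆xs)

  Unique-⊆⇒⊇ : DecidableEquality A → {xs ys : List A} → Unique xs → xs ⊆ ys →
               length ys ≤ length xs → ys ⊆ xs
  Unique-⊆⇒⊇ _≟_ {xs} !xs xs⊆ys ys≤xs {y} y∈ys with DecMembership._∈?_ _≟_ y xs
  ... | yes y∈xs = y∈xs
  ... | no y∉xs = contradiction ys≤xs (<⇒≱ (Unique-⊆⇒length< !xs xs⊆ys y∈ys y∉xs))

  length>0⇒∈ : (xs : List A) → 0 < length xs → ∃ λ x → x ∈ xs
  length>0⇒∈ (x ∷ _) _ = x , here refl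

module _ {A B : Set} where

  Unique-map⁺-local : (f : A → B) {xs : List A} → (∀ {x y} → x ∈ xs → y ∈ xs → f x ≡ f y → x ≡ y) →
                      Unique xs → Unique (map f xs)
  Unique-map⁺-local f {[]} _ _ = Unique.[]
  Unique-map⁺-local f {x ∷ xs} inj (x∉xs ∷ !xs) =
    All.tabulate fresh ∷ Unique-map⁺-local f (λ p q → inj (there p) (there q)) !xs
    where
    fresh : ∀ {z} → z ∈ map f xs → f x ≢ z
    fresh fy∈ refl with ∈-map⁻ f fy∈
    ... | y , y∈xs , fx≡fy = All.lookup x∉xs y∈xs (inj (here refl) (there y∈xs) fx≡fy)

  length-concatMap≤ : (f : A → List B) (k : ℕ) (xs : List A) →
                      (∀ {x} → x ∈ xs → length (f x) ≤ k) → length (concatMap f xs) ≤ k * length xs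
  length-concatMap≤ f k [] _ = z≤n
  length-concatMap≤ f k (x ∷ xs) bound
    rewrite length-++ (f x) {concatMap f xs} | *-suc k (length xs) =
    +-mono-≤ (bound (here refl)) (length-concatMap≤ f k xs (λ x∈ → bound (there x∈)))

module _ {A : Set} {P : Pred A 0ℓ} (P? : Decidable P) where

  findFirst-just : ∀ xs {y} → findFirst P? xs ≡ just y → y ∈ xs × P y
  findFirst-just (x ∷ xs) eq with P? x
  findFirst-just (x ∷ xs) refl | yes px = here refl , px
  ... | no _ = let y∈xs , py = findFirst-just xs eq in there y∈xs , py

  findFirst-nothing : ∀ xs {x} → findFirst P? xs ≡ nothing → x ∈ xs → ¬ P x
  findFirst-nothing (y ∷ xs) eq x∈ px with P? y
  findFirst-nothing (y ∷ xs) () x∈ px | yes _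
  findFirst-nothing (y ∷ xs) eq (here refl) px | no ¬py = ¬py px
  findFirst-nothing (y ∷ xs) eq (there x∈) px | no _ = findFirst-nothing xs eq x∈ px

  findFirst-≡ : ∀ {Q : Pred A 0ℓ} (Q? : Decidable Q) xs {y z} →
                findFirst P? xs ≡ just y → findFirst Q? xs ≡ just z → Q y → P z → y ≡ z
  findFirst-≡ Q? (x ∷ xs) eqP eqQ qy pz with P? x | Q? x
  findFirst-≡ Q? (x ∷ xs) refl refl qy pz | yes _ | yes _ = refl
  findFirst-≡ Q? (x ∷ xs) refl eqQ qy pz | yes _ | no ¬qx = contradiction qy ¬qx
  findFirst-≡ Q? (x ∷ xs) eqP refl qy pz | no ¬px | yes _ = contradiction pz ¬px
  findFirst-≡ Q? (x ∷ xs) eqP eqQ qy pz | no _ | no _ = findFirst-≡ Q? xs eqP eqQ qy pz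

module _ {A : Set} (_≟_ : DecidableEquality A) where

  rotate₃ : A → A → A → A → A
  rotate₃ a b c x with x ≟ a | x ≟ b
  ... | yes _ | _ = b
  ... | no _ | yes _ = c
  ... | no _ | no _ = a

  module _ {a b c : A} (a≢b : a ≢ b) (a≢c : a ≢ c) (b≢c : b ≢ c) where

    rotate₃-a : rotate₃ a b c a ≡ b
    rotate₃-a with a ≟ a
    ... | yes _ = refl
    ... | no a≢a = contradiction refl a≢a

    rotate₃-b : rotate₃ a b c b ≡ c
    rotate₃-b with b ≟ a | b ≟ b
    ... | yes b≡a | _ = contradiction (sym b≡a) a≢b
    ... | no _ | yes _ = refl
    ... | no _ | no b≢b = contradiction refl b≢b

    rotate₃-other : ∀ {x} → x ≢ a → x ≢ b → rotate₃ a b c x ≡ a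
    rotate₃-other {x} x≢a x≢b with x ≟ a | x ≟ b
    ... | yes x≡a | _ = contradiction x≡a x≢a
    ... | no _ | yes x≡b = contradiction x≡b x≢b
    ... | no _ | no _ = refl

    data Rotate₃View (x : A) : Set where
      at-a : x ≡ a → Rotate₃View x
      at-b : x ≡ b → Rotate₃View x
      other : x ≢ a → x ≢ b → Rotate₃View x

    rotate₃-view : ∀ x → Rotate₃View x
    rotate₃-view x with x ≟ a | x ≟ b
    ... | yes x≡a | _ = at-a x≡a
    ... | no _ | yes x≡b = at-b x≡b
    ... | no x≢a | no x≢b = other x≢a x≢b

    private
      c≢a : c ≢ a
      c≢a = ≢-sym a≢c

      c≢b : c ≢ b
      c≢b = ≢-sym b≢c

    rotate₃-∈ : ∀ x → rotate₃ a b c x ∈ a ∷ b ∷ c ∷ []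
    rotate₃-∈ x with rotate₃-view x
    ... | at-a refl rewrite rotate₃-a = there (here refl)
    ... | at-b refl rewrite rotate₃-b = there (there (here refl))
    ... | other x≢a x≢b rewrite rotate₃-other x≢a x≢b = here refl

    rotate₃-≢ : ∀ x → rotate₃ a b c x ≢ x
    rotate₃-≢ x with rotate₃-view x
    ... | at-a refl rewrite rotate₃-a = ≢-sym a≢b
    ... | at-b refl rewrite rotate₃-b = c≢b
    ... | other x≢a x≢b rewrite rotate₃-other x≢a x≢b = ≢-sym x≢a

    rotate₃-rotate₃-≢ : ∀ x → rotate₃ a b c (rotate₃ a b c x) ≢ x
    rotate₃-rotate₃-≢ x with rotate₃-view x
    ... | at-a refl rewrite rotate₃-a | rotate₃-b = c≢a
    ... | at-b refl rewrite rotate₃-b | rotate₃-other c≢a c≢b = a≢b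
    ... | other x≢a x≢b rewrite rotate₃-other x≢a x≢b | rotate₃-a = ≢-sym x≢b

  rotate : List A → A → A
  rotate (a ∷ b ∷ c ∷ _) = rotate₃ a b c
  rotate _ x = x

  data Distinct₃ : List A → Set where
    distinct₃ : ∀ {a b c} rest → a ≢ b → a ≢ c → b ≢ c → Distinct₃ (a ∷ b ∷ c ∷ rest)

  Unique⇒Distinct₃ : ∀ {xs} → Unique xs → 3 ≤ length xs → Distinct₃ xs
  Unique⇒Distinct₃ {_ ∷ _ ∷ _ ∷ rest} ((a≢b ∷ a≢c ∷ _) ∷ (b≢c ∷ _) ∷ _) _ =
    distinct₃ rest a≢b a≢c b≢c
  Unique⇒Distinct₃ {[]} _ ()
  Unique⇒Distinct₃ {_ ∷ []} _ (s≤s ())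
  Unique⇒Distinct₃ {_ ∷ _ ∷ []} _ (s≤s (s≤s ()))

  rotate-∈ : ∀ {xs} → Distinct₃ xs → ∀ x → rotate xs x ∈ xs
  rotate-∈ (distinct₃ rest a≢b a≢c b≢c) x with rotate₃-∈ a≢b a≢c b≢c x
  ... | here eq = here eq
  ... | there (here eq) = there (here eq)
  ... | there (there (here eq)) = there (there (here eq))

  rotate-≢ : ∀ {xs} → Distinct₃ xs → ∀ x → rotate xs x ≢ x
  rotate-≢ (distinct₃ _ a≢b a≢c b≢c) = rotate₃-≢ a≢b a≢c b≢c

  rotate-rotate-≢ : ∀ {xs} → Distinct₃ xs → ∀ x → rotate xs (rotate xs x) ≢ x
  rotate-rotate-≢ (distinct₃ _ a≢b a≢c b≢c) = rotate₃-rotate₃-≢ a≢b a≢c b≢c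



-- Monomials

one : Monomial s
one = Vec.replicate _ 0

var : Fin s → Monomial s
var i = one [ i ]≔ 1

infixl 30 _·_ _÷_

_·_ : Monomial s → Monomial s → Monomial s
_·_ = zipWith _+_

_÷_ : Monomial s → Monomial s → Monomial s
_÷_ = zipWith _∸_

_≟ₘ_ : DecidableEquality (Monomial s)
_≟ₘ_ = ≡-dec _≟ℕ_

_∣?_ : ∀ (u v : Monomial s) → Dec (u ∣ₘ v)
_∣?_ = Pointwise.decidable _≤?_

lookup-ext : (∀ i → lookup u i ≡ lookup v i) → u ≡ v
lookup-ext = Pointwise-≡⇒≡ ∘′ extensional⇒inductive ∘′ ext

∣-lookup : (∀ i → lookup u i ≤ lookup v i) → u ∣ₘ v
∣-lookup le = extensional⇒inductive (ext le)

∣-refl : u ∣ₘ u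
∣-refl = Pointwise.refl ≤-refl

∣-trans : u ∣ₘ v → v ∣ₘ w → u ∣ₘ w
∣-trans = Pointwise.trans ≤-trans

lookup-one : ∀ (i : Fin s) → lookup one i ≡ 0
lookup-one i = lookup-replicate i 0

one∣ : ∀ (u : Monomial s) → one ∣ₘ u
one∣ u = ∣-lookup λ i → subst (_≤ lookup u i) (sym (lookup-one i)) z≤n

lookup-var-self : ∀ (i : Fin s) → lookup (var i) i ≡ 1
lookup-var-self i = lookup∘update i one 1

lookup-var-other : i ≢ j → lookup (var i) j ≡ 0
lookup-var-other {j = j} i≢j = trans (lookup∘update′ (≢-sym i≢j) one 1) (lookup-one j)

lookup-· : ∀ (u v : Monomial s) i → lookup (u · v) i ≡ lookup u i + lookup v i
lookup-· u v i = lookup-zipWith _+_ i u v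

lookup-÷ : ∀ (u v : Monomial s) i → lookup (u ÷ v) i ≡ lookup u i ∸ lookup v i
lookup-÷ u v i = lookup-zipWith _∸_ i u v

lookup-÷var-self : ∀ t (i : Fin s) → lookup (t ÷ var i) i ≡ lookup t i ∸ 1
lookup-÷var-self t i = trans (lookup-÷ t (var i) i) (cong (lookup t i ∸_) (lookup-var-self i))

lookup-÷var-other : ∀ t → i ≢ j → lookup (t ÷ var i) j ≡ lookup t j
lookup-÷var-other {j = j} t i≢j = trans (lookup-÷ t _ j) (cong (lookup t j ∸_) (lookup-var-other i≢j))

·-comm : ∀ (u v : Monomial s) → u · v ≡ v · u
·-comm u v = lookup-ext λ i →
  trans (lookup-· u v i) (trans (+-comm (lookup u i) _) (sym (lookup-· v u i)))

·-cancelˡ : ∀ (u : Monomial s) → u · v ≡ u · w → v ≡ w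
·-cancelˡ {v = v} {w} u eq = lookup-ext λ i → +-cancelˡ-≡ (lookup u i) _ _
  (trans (sym (lookup-· u v i)) (trans (cong (λ x → lookup x i) eq) (lookup-· u w i)))

·÷-cancelʳ : ∀ (u v : Monomial s) → u · v ÷ v ≡ u
·÷-cancelʳ u v = lookup-ext λ i → trans (lookup-÷ (u · v) v i)
  (trans (cong (_∸ lookup v i) (lookup-· u v i)) (m+n∸n≡m (lookup u i) (lookup v i)))

∣⇒≡·÷ : u ∣ₘ t → t ≡ u · (t ÷ u)
∣⇒≡·÷ {u = u} {t} u∣t = lookup-ext λ i → sym (begin
  lookup (u · (t ÷ u)) i          ≡⟨ lookup-· u (t ÷ u) i ⟩
  lookup u i + lookup (t ÷ u) i   ≡⟨ cong (lookup u i +_) (lookup-÷ t u i) ⟩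
  lookup u i + (lookup t i ∸ lookup u i) ≡⟨ m+[n∸m]≡n (Pointwise.lookup u∣t i) ⟩
  lookup t i                      ∎)
  where open ≡-Reasoning

÷∣ : ∀ (t u : Monomial s) → t ÷ u ∣ₘ t
÷∣ t u = ∣-lookup λ i → subst (_≤ lookup t i) (sym (lookup-÷ t u i)) (m∸n≤m (lookup t i) (lookup u i))

·∣ : u ∣ₘ t → v ∣ₘ t ÷ u → u · v ∣ₘ t
·∣ {u = u} {t} {v} u∣t v∣t÷u = ∣-lookup λ i → subst (_≤ lookup t i) (sym (lookup-· u v i))
  (subst (lookup u i + lookup v i ≤_) (m+[n∸m]≡n (Pointwise.lookup u∣t i))
    (+-monoʳ-≤ (lookup u i) (subst (lookup v i ≤_) (lookup-÷ t u i) (Pointwise.lookup v∣t÷u i))))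

var∣⇒ : var i ∣ₘ t → 1 ≤ lookup t i
var∣⇒ {i = i} {t} x∣t = subst (_≤ lookup t i) (lookup-var-self i) (Pointwise.lookup x∣t i)

⇒var∣ : 1 ≤ lookup t i → var i ∣ₘ t
⇒var∣ {t = t} {i} 1≤tᵢ = ∣-lookup λ j → bound j (i ≟ᶠ j)
  where
  bound : ∀ j → Dec (i ≡ j) → lookup (var i) j ≤ lookup t j
  bound j (yes refl) = subst (_≤ lookup t i) (sym (lookup-var-self i)) 1≤tᵢ
  bound j (no i≢j) = subst (_≤ lookup t j) (sym (lookup-var-other i≢j)) z≤n

var·var∣ : i ≢ j → 1 ≤ lookup t i → 1 ≤ lookup t j → var i · var j ∣ₘ t
var·var∣ {t = t} i≢j 1≤tᵢ 1≤tⱼ =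
  ·∣ (⇒var∣ 1≤tᵢ) (⇒var∣ (subst (1 ≤_) (sym (lookup-÷var-other t i≢j)) 1≤tⱼ))

var²∣ : 2 ≤ lookup t i → var i · var i ∣ₘ t
var²∣ {t = t} {i} 2≤tᵢ =
  ·∣ (⇒var∣ (≤-trans (s≤s z≤n) 2≤tᵢ))
     (⇒var∣ (subst (1 ≤_) (sym (lookup-÷var-self t i)) (∸-monoˡ-≤ 1 2≤tᵢ)))

var-injective : var i ≡ var j → i ≡ j
var-injective {i = i} {j} eq with i ≟ᶠ j
... | yes i≡j = i≡j
... | no i≢j = contradiction (trans (sym (lookup-var-self i)) (trans (cong (λ x → lookup x i) eq)
                 (lookup-var-other (≢-sym i≢j)))) λ ()

var·var-injective : ∀ {a b c d : Fin s} → var a · var b ≡ var c · var d →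
                    (a ≡ c × b ≡ d) ⊎ (a ≡ d × b ≡ c)
var·var-injective {a = a} {b} {c} {d} eq with c ≟ᶠ a | d ≟ᶠ a
... | yes refl | _ = inj₁ (refl , var-injective (·-cancelˡ (var a) eq))
... | no _ | yes refl = inj₂ (refl , var-injective (·-cancelˡ (var a) (trans eq (·-comm (var c) (var a)))))
... | no c≢a | no d≢a = contradiction (trans (sym lhs) (trans (cong (λ x → lookup x a) eq) rhs)) λ ()
  where
  lhs : lookup (var a · var b) a ≡ suc (lookup (var b) a)
  lhs = trans (lookup-· (var a) (var b) a) (cong (_+ lookup (var b) a) (lookup-var-self a))
  rhs : lookup (var c · var d) a ≡ 0
  rhs = trans (lookup-· (var c) (var d) a) (cong₂ _+_ (lookup-var-other c≢a) (lookup-var-other d≢a))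

deg-one : deg (one {s}) ≡ 0
deg-one {zero} = refl
deg-one {suc s} = deg-one {s}

deg-var : ∀ (i : Fin s) → deg (var i) ≡ 1
deg-var {suc s} zero = cong suc (deg-one {s})
deg-var (suc i) = deg-var i

deg-· : ∀ (u v : Monomial s) → deg (u · v) ≡ deg u + deg v
deg-· [] [] = refl
deg-· (x ∷ u) (y ∷ v) = trans (cong (x + y +_) (deg-· u v)) (interchange x y (deg u) (deg v))

deg≡0⇒≡one : deg t ≡ 0 → t ≡ one
deg≡0⇒≡one {t = []} _ = refl
deg≡0⇒≡one {t = zero ∷ t} deg≡0 = cong (0 ∷_) (deg≡0⇒≡one deg≡0)

deg≡1⇒var : deg t ≡ 1 → ∃ λ i → t ≡ var i
deg≡1⇒var {t = zero ∷ t} deg≡1 with deg≡1⇒var {t = t} deg≡1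
... | i , t≡xᵢ = suc i , cong (0 ∷_) t≡xᵢ
deg≡1⇒var {t = suc zero ∷ t} deg≡1 = zero , cong (1 ∷_) (deg≡0⇒≡one (suc-injective deg≡1))

lookup≤deg : ∀ (t : Monomial s) i → lookup t i ≤ deg t
lookup≤deg (x ∷ t) zero = m≤m+n x (deg t)
lookup≤deg (x ∷ t) (suc i) = ≤-trans (lookup≤deg t i) (m≤n+m (deg t) x)

deg-[]≔0 : ∀ (t : Monomial s) i → deg t ≡ lookup t i + deg (t [ i ]≔ 0)
deg-[]≔0 (x ∷ t) zero = refl
deg-[]≔0 (x ∷ t) (suc i) = begin
  x + deg t                                 ≡⟨ cong (x +_) (deg-[]≔0 t i) ⟩
  x + (lookup t i + deg (t [ i ]≔ 0))       ≡⟨ x∙yz≈y∙xz x (lookup t i) _ ⟩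
  lookup t i + (x + deg (t [ i ]≔ 0))       ∎
  where open ≡-Reasoning

∣⇒deg≤ : u ∣ₘ v → deg u ≤ deg v
∣⇒deg≤ [] = z≤n
∣⇒deg≤ (x≤y ∷ u∣v) = +-mono-≤ x≤y (∣⇒deg≤ u∣v)

∣∧deg≥⇒≡ : u ∣ₘ v → deg v ≤ deg u → u ≡ v
∣∧deg≥⇒≡ {u = []} {[]} [] _ = refl
∣∧deg≥⇒≡ {u = x ∷ u} {y ∷ v} (x≤y ∷ u∣v) deg≥ with m≤n⇒m<n∨m≡n x≤y
... | inj₂ refl = cong (x ∷_) (∣∧deg≥⇒≡ u∣v (+-cancelˡ-≤ x _ _ deg≥))
... | inj₁ x<y = contradiction deg≥ (<⇒≱ (+-mono-<-≤ x<y (∣⇒deg≤ u∣v)))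

∣∧≢⇒deg< : u ∣ₘ v → v ≢ u → deg u < deg v
∣∧≢⇒deg< u∣v v≢u = ≰⇒> λ deg≥ → v≢u (sym (∣∧deg≥⇒≡ u∣v deg≥))

supp : Monomial s → List (Fin s)
supp [] = []
supp (zero ∷ t) = map suc (supp t)
supp (suc _ ∷ t) = zero ∷ map suc (supp t)

∈-supp⁻ : ∀ (t : Monomial s) {i} → i ∈ supp t → 1 ≤ lookup t i
∈-supp⁻ (zero ∷ t) i∈ with ∈-map⁻ suc i∈
... | j , j∈ , refl = ∈-supp⁻ t j∈
∈-supp⁻ (suc x ∷ t) (here refl) = s≤s z≤n
∈-supp⁻ (suc x ∷ t) (there i∈) with ∈-map⁻ suc i∈
... | j , j∈ , refl = ∈-supp⁻ t j∈

∈-supp⁺ : ∀ (t : Monomial s) {i} → 1 ≤ lookup t i → i ∈ supp t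
∈-supp⁺ (zero ∷ t) {suc i} 1≤tᵢ = ∈-map⁺ suc (∈-supp⁺ t 1≤tᵢ)
∈-supp⁺ (suc x ∷ t) {zero} _ = here refl
∈-supp⁺ (suc x ∷ t) {suc i} 1≤tᵢ = there (∈-map⁺ suc (∈-supp⁺ t 1≤tᵢ))

Unique-supp : ∀ (t : Monomial s) → Unique (supp t)
Unique-supp [] = Unique.[]
Unique-supp (zero ∷ t) = Unique.map⁺ FinP.suc-injective (Unique-supp t)
Unique-supp (suc x ∷ t) = All.tabulate zero∉ ∷ Unique.map⁺ FinP.suc-injective (Unique-supp t)
  where
  zero∉ : ∀ {j} → j ∈ map suc (supp t) → zero ≢ j
  zero∉ j∈ refl with ∈-map⁻ suc j∈
  ... | _ , _ , ()

length-supp≤deg : ∀ (t : Monomial s) → length (supp t) ≤ deg t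
length-supp≤deg [] = z≤n
length-supp≤deg (zero ∷ t) = subst (_≤ deg t) (sym (length-map suc (supp t))) (length-supp≤deg t)
length-supp≤deg (suc x ∷ t) =
  s≤s (subst (_≤ x + deg t) (sym (length-map suc (supp t))) (≤-trans (length-supp≤deg t) (m≤n+m (deg t) x)))

Squarefree : Monomial s → Set
Squarefree t = ∀ i → lookup t i ≤ 1

deg≤length-supp : ∀ (t : Monomial s) → Squarefree t → deg t ≤ length (supp t)
deg≤length-supp [] _ = z≤n
deg≤length-supp (zero ∷ t) sf =
  subst (deg t ≤_) (sym (length-map suc (supp t))) (deg≤length-supp t (λ i → sf (suc i)))
deg≤length-supp (suc zero ∷ t) sf =
  s≤s (subst (deg t ≤_) (sym (length-map suc (supp t))) (deg≤length-supp t (λ i → sf (suc i))))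
deg≤length-supp (suc (suc x) ∷ t) sf = contradiction (sf zero) λ { (s≤s ()) }

lookup+lookup≤deg : ∀ (t : Monomial s) {i j} → i ≢ j → lookup t i + lookup t j ≤ deg t
lookup+lookup≤deg t {i} {j} i≢j = subst (lookup t i + lookup t j ≤_) (sym (deg-[]≔0 t i))
  (+-monoʳ-≤ (lookup t i)
    (subst (_≤ deg (t [ i ]≔ 0)) (lookup∘update′ (≢-sym i≢j) t 0) (lookup≤deg (t [ i ]≔ 0) j)))

deg-÷var : ∀ {t : Monomial s} {i} → 1 ≤ lookup t i → deg t ≡ suc (deg (t ÷ var i))
deg-÷var {t = t} {i} 1≤tᵢ = trans (cong deg (∣⇒≡·÷ {u = var i} (⇒var∣ 1≤tᵢ)))
  (trans (deg-· (var i) (t ÷ var i)) (cong (_+ deg (t ÷ var i)) (deg-var i)))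

-- Order ideals and h-vectors

applyUpTo≡replicate++⇔ : ∀ {A : Set} {f : ℕ → A} {a b} m →
  applyUpTo f (suc m) ≡ replicate m a ++ b ∷ [] ⇔ ((∀ i → i < m → f i ≡ a) × f m ≡ b)
applyUpTo≡replicate++⇔ zero =
  mk⇔ (λ eq → (λ _ ()) , proj₁ (∷-injective eq)) (λ (_ , f0≡b) → cong (_∷ []) f0≡b)
applyUpTo≡replicate++⇔ {f = f} (suc m) = mk⇔
  (λ eq → let f0≡a , rest = ∷-injective eq
              mid , top = Equivalence.to (applyUpTo≡replicate++⇔ {f = f ∘ suc} m) rest
          in (λ { zero _ → f0≡a ; (suc i) (s≤s i<m) → mid i i<m }) , top)
  (λ (mid , top) → cong₂ _∷_ (mid 0 (s≤s z≤n))
     (Equivalence.from (applyUpTo≡replicate++⇔ {f = f ∘ suc} m) ((λ i i<m → mid (suc i) (s≤s i<m)) , top)))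

module _ {s : ℕ} (A : OrderIdeal s) where

  layer : ℕ → List (Monomial s)
  layer k = filter (λ u → deg u ≟ℕ k) (elems A)

  ∈-layer⁺ : ∀ {k u} → u ∈ elems A → deg u ≡ k → u ∈ layer k
  ∈-layer⁺ {k} = ∈-filter⁺ (λ u → deg u ≟ℕ k)

  ∈-layer⁻ : ∀ {k u} → u ∈ layer k → u ∈ elems A × deg u ≡ k
  ∈-layer⁻ {k} = ∈-filter⁻ (λ u → deg u ≟ℕ k)

  Unique-layer : ∀ k → Unique (layer k)
  Unique-layer k = Unique.filter⁺ (λ u → deg u ≟ℕ k) (unique A)

  one∈ : one ∈ elems A
  one∈ = closedNonempty⇒one∈ (elems A) (nonempty A) (downward A)
    where
    closedNonempty⇒one∈ : ∀ xs → xs ≢ [] → (∀ {u v} → u ∈ xs → v ∣ₘ u → v ∈ xs) → one ∈ xs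
    closedNonempty⇒one∈ [] xs≢[] _ = contradiction refl xs≢[]
    closedNonempty⇒one∈ (u ∷ _) _ down = down (here refl) (one∣ u)

  ≤maxDeg : ∀ {u} → u ∈ elems A → deg u ≤ maxDeg A
  ≤maxDeg u∈A = All.lookup (All.map⁻ (foldr-forcesᵇ ⊔-bounded 0 (map deg (elems A)) ≤-refl)) u∈A
    where
    ⊔-bounded : ∀ x y → x ⊔ y ≤ maxDeg A → x ≤ maxDeg A × y ≤ maxDeg A
    ⊔-bounded x y x⊔y≤ = ≤-trans (m≤m⊔n x y) x⊔y≤ , ≤-trans (m≤n⊔m x y) x⊔y≤

  maxDeg-attained : ∃ λ u → u ∈ elems A × deg u ≡ maxDeg A
  maxDeg-attained with foldr-selective ⊔-sel 0 (map deg (elems A))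
  ... | inj₁ max≡0 = one , one∈ , trans (deg-one {s}) (sym max≡0)
  ... | inj₂ max∈ with ∈-map⁻ deg max∈
  ...   | u , u∈A , max≡deg = u , u∈A , sym max≡deg

  maxDeg-≡ : ∀ {n} → (∀ {u} → u ∈ elems A → deg u ≤ n) → (∃ λ u → u ∈ elems A × deg u ≡ n) →
             maxDeg A ≡ n
  maxDeg-≡ {n} bound (u , u∈A , deg≡n) =
    ≤-antisym (foldr-preservesᵇ {P = _≤ n} ⊔-lub z≤n (All.map⁺ (All.tabulate bound)))
              (subst (_≤ maxDeg A) deg≡n (≤maxDeg u∈A))

  deg≡maxDeg⇒maximal : ∀ {u} → u ∈ elems A → deg u ≡ maxDeg A → IsMaximal A u
  deg≡maxDeg⇒maximal u∈A deg≡max =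
    u∈A , λ v∈A u∣v → sym (∣∧deg≥⇒≡ u∣v (subst (_ ≤_) (sym deg≡max) (≤maxDeg v∈A)))

  ∣-maximal : ∀ {u} → u ∈ elems A → ∃ λ m → IsMaximal A m × u ∣ₘ m
  ∣-maximal u∈A = go (maxDeg A) u∈A (m≤m+n (maxDeg A) _)
    where
    go : ∀ k {u} → u ∈ elems A → maxDeg A ≤ k + deg u → ∃ λ m → IsMaximal A m × u ∣ₘ m
    go k {u} u∈A bound with Any.any? (λ v → (u ∣? v) ×-dec ¬? (v ≟ₘ u)) (elems A)
    ... | no noneAbove = u , (u∈A , maximal) , ∣-refl
      where
      maximal : ∀ {v} → v ∈ elems A → u ∣ₘ v → v ≡ u
      maximal {v} v∈A u∣v with v ≟ₘ u
      ... | yes v≡u = v≡u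
      ... | no v≢u = contradiction (Any.map (λ { refl → u∣v , v≢u }) v∈A) noneAbove
    ... | yes someAbove with find someAbove | k
    ...   | v , v∈A , u∣v , v≢u | zero =
      contradiction (≤-trans (≤maxDeg v∈A) bound) (<⇒≱ (∣∧≢⇒deg< u∣v v≢u))
    ...   | v , v∈A , u∣v , v≢u | suc k′
      with go k′ v∈A (≤-trans bound
                (subst (_≤ k′ + deg v) (+-suc k′ (deg u)) (+-monoʳ-≤ k′ (∣∧≢⇒deg< u∣v v≢u))))
    ...     | m , m-max , v∣m = m , m-max , ∣-trans u∣v v∣m

  Pure⇒deg≡maxDeg : Pure A → ∀ {m} → IsMaximal A m → deg m ≡ maxDeg A
  Pure⇒deg≡maxDeg pure m-max with maxDeg-attained
  ... | u , u∈A , deg≡max = trans (pure m-max (deg≡maxDeg⇒maximal u∈A deg≡max)) deg≡max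

  countDeg-zero : countDeg A 0 ≡ 1
  countDeg-zero = Unique-⊆⇒length≡ (Unique-layer 0) (All.[] AllPairs.∷ AllPairs.[])
    (λ u∈ → here (deg≡0⇒≡one (proj₂ (∈-layer⁻ u∈))))
    λ { (here refl) → ∈-layer⁺ one∈ (deg-one {s}) }

  hVector-unfold : hVector A ≡ 1 ∷ applyUpTo (λ i → countDeg A (suc i)) (maxDeg A)
  hVector-unfold = trans (map-upTo (countDeg A) _)
    (cong (_∷ applyUpTo (λ i → countDeg A (suc i)) (maxDeg A)) countDeg-zero)

  hVector≡⇔ : ∀ m a b → hVector A ≡ 1 ∷ replicate m a ++ b ∷ [] ⇔
              (maxDeg A ≡ suc m × (∀ i → i < m → countDeg A (suc i) ≡ a) × countDeg A (suc m) ≡ b)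
  hVector≡⇔ m a b = mk⇔ to from
    where
    g : ℕ → ℕ
    g i = countDeg A (suc i)
    to : hVector A ≡ 1 ∷ replicate m a ++ b ∷ [] →
         maxDeg A ≡ suc m × (∀ i → i < m → countDeg A (suc i) ≡ a) × countDeg A (suc m) ≡ b
    to eq = maxDeg≡ ,
      Equivalence.to (applyUpTo≡replicate++⇔ m) (subst (λ N → applyUpTo g N ≡ _) maxDeg≡ tail≡)
      where
      tail≡ : applyUpTo g (maxDeg A) ≡ replicate m a ++ b ∷ []
      tail≡ = proj₂ (∷-injective (trans (sym hVector-unfold) eq))
      maxDeg≡ : maxDeg A ≡ suc m
      maxDeg≡ = begin
        maxDeg A                                ≡⟨ length-applyUpTo g (maxDeg A) ⟨
        length (applyUpTo g (maxDeg A))         ≡⟨ cong length tail≡ ⟩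
        length (replicate m a ++ b ∷ [])        ≡⟨ length-++ (replicate m a) ⟩
        length (replicate m a) + 1              ≡⟨ cong (_+ 1) (length-replicate m) ⟩
        m + 1                                   ≡⟨ +-comm m 1 ⟩
        suc m                                   ∎
        where open ≡-Reasoning
    from : maxDeg A ≡ suc m × (∀ i → i < m → countDeg A (suc i) ≡ a) × countDeg A (suc m) ≡ b →
           hVector A ≡ 1 ∷ replicate m a ++ b ∷ []
    from (maxDeg≡ , counts) = trans hVector-unfold (cong (1 ∷_)
      (subst (λ N → applyUpTo g N ≡ _) (sym maxDeg≡) (Equivalence.from (applyUpTo≡replicate++⇔ m) counts)))

-- Principal order ideals and wedges

divisors : Monomial s → List (Monomial s)
divisors [] = [] ∷ []
divisors (c ∷ m) = cartesianProductWith _∷_ (upTo (suc c)) (divisors m)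

∈-divisors⁺ : ∀ {u m : Monomial s} → u ∣ₘ m → u ∈ divisors m
∈-divisors⁺ [] = here refl
∈-divisors⁺ (x≤c ∷ u∣m) = ∈-cartesianProductWith⁺ _∷_ (∈-upTo⁺ (s≤s x≤c)) (∈-divisors⁺ u∣m)

∈-divisors⁻ : ∀ {u : Monomial s} m → u ∈ divisors m → u ∣ₘ m
∈-divisors⁻ [] (here refl) = []
∈-divisors⁻ (c ∷ m) u∈ with ∈-cartesianProductWith⁻ _∷_ (upTo (suc c)) (divisors m) u∈
... | x , v , x∈ , v∈ , refl = ≤-pred (∈-upTo⁻ x∈) ∷ ∈-divisors⁻ m v∈

Unique-divisors : ∀ (m : Monomial s) → Unique (divisors m)
Unique-divisors [] = All.[] AllPairs.∷ AllPairs.[]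
Unique-divisors (c ∷ m) = Unique.cartesianProductWith⁺ _∷_ (λ { refl → refl , refl })
  (Unique.upTo⁺ (suc c)) (Unique-divisors m)

principal : Monomial s → OrderIdeal s
principal m = record
  { elems = divisors m
  ; unique = Unique-divisors m
  ; nonempty = λ eq → case subst (m ∈_) eq (∈-divisors⁺ ∣-refl) of λ ()
  ; downward = λ u∈ v∣u → ∈-divisors⁺ {m = m} (∣-trans v∣u (∈-divisors⁻ m u∈))
  }

maximal-principal : ∀ {m u : Monomial s} → IsMaximal (principal m) u → u ≡ m
maximal-principal {m = m} (u∈ , max) = sym (max (∈-divisors⁺ {m = m} ∣-refl) (∈-divisors⁻ m u∈))

Pure-principal : ∀ (m : Monomial s) → Pure (principal m)
Pure-principal m u-max v-max =
  cong deg (trans (maximal-principal {m = m} u-max) (sym (maximal-principal {m = m} v-max)))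

maxDeg-principal : ∀ (m : Monomial s) → maxDeg (principal m) ≡ deg m
maxDeg-principal m = maxDeg-≡ (principal m) (λ {u} u∈ → ∣⇒deg≤ (∈-divisors⁻ {u = u} m u∈))
  (m , ∈-divisors⁺ {m = m} ∣-refl , refl)

inl : Monomial s → Monomial (s + r)
inl u = u Vec.++ one

inr : Monomial r → Monomial (s + r)
inr v = one Vec.++ v

deg-inl : ∀ (u : Monomial s) → deg (inl {r = r} u) ≡ deg u
deg-inl {r = r} u = trans (sum-++ u) (trans (cong (deg u +_) (deg-one {r})) (+-identityʳ (deg u)))

deg-inr : ∀ (v : Monomial r) → deg (inr {s = s} v) ≡ deg v
deg-inr {s = s} v = trans (sum-++ (one {s})) (cong (_+ deg v) (deg-one {s}))

∣one⇒≡one : ∀ {u : Monomial s} → u ∣ₘ one → u ≡ one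
∣one⇒≡one {s} {u} u∣one = deg≡0⇒≡one (n≤0⇒n≡0 (subst (deg u ≤_) (deg-one {s}) (∣⇒deg≤ u∣one)))

inl≢inr : ∀ {u : Monomial s} {v : Monomial r} → v ≢ one → inl u ≢ inr v
inl≢inr {u = u} v≢one eq = v≢one (sym (++-injectiveʳ u one eq))

-- A ∨ B lives in s + r variables: A on the first s of them and B on the last r, sharing only 1.
module _ {s r : ℕ} (A : OrderIdeal s) (B : OrderIdeal r) where

  private
    ι₁ : Monomial s → Monomial (s + r)
    ι₁ = inl
    ι₂ : Monomial r → Monomial (s + r)
    ι₂ = inr
    deg-ι₁ : ∀ u → deg (ι₁ u) ≡ deg u
    deg-ι₁ = deg-inl
    deg-ι₂ : ∀ v → deg (ι₂ v) ≡ deg v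
    deg-ι₂ = deg-inr {s = s}

  nontrivial : List (Monomial r)
  nontrivial = filter (λ v → ¬? (v ≟ₘ one)) (elems B)

  wedge-elems : List (Monomial (s + r))
  wedge-elems = map ι₁ (elems A) ++ map ι₂ nontrivial

  data WedgeView (w : Monomial (s + r)) : Set where
    left : ∀ {u} → u ∈ elems A → w ≡ ι₁ u → WedgeView w
    right : ∀ {v} → v ∈ elems B → v ≢ one → w ≡ ι₂ v → WedgeView w

  wedge-view : ∀ {w} → w ∈ wedge-elems → WedgeView w
  wedge-view w∈ with ∈-++⁻ (map ι₁ (elems A)) w∈
  ... | inj₁ w∈ˡ = let u , u∈A , w≡ = ∈-map⁻ ι₁ w∈ˡ in left u∈A w≡
  ... | inj₂ w∈ʳ = let v , v∈ , w≡ = ∈-map⁻ ι₂ w∈ʳ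
                       v∈B , v≢one = ∈-filter⁻ (λ v → ¬? (v ≟ₘ one)) v∈ in right v∈B v≢one w≡

  inl∈wedge : ∀ {u} → u ∈ elems A → ι₁ u ∈ wedge-elems
  inl∈wedge u∈A = ∈-++⁺ˡ (∈-map⁺ ι₁ u∈A)

  inr∈wedge : ∀ {v} → v ∈ elems B → v ≢ one → ι₂ v ∈ wedge-elems
  inr∈wedge v∈B v≢one =
    ∈-++⁺ʳ (map ι₁ (elems A)) (∈-map⁺ ι₂ (∈-filter⁺ (λ v → ¬? (v ≟ₘ one)) v∈B v≢one))

  Unique-wedge : Unique wedge-elems
  Unique-wedge = Unique.++⁺ (Unique.map⁺ (++-injectiveˡ _ _) (unique A))
    (Unique.map⁺ (++-injectiveʳ one one) (Unique.filter⁺ (λ v → ¬? (v ≟ₘ one)) (unique B)))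
    λ (w∈ˡ , w∈ʳ) → let u , _ , w≡ι₁ = ∈-map⁻ ι₁ w∈ˡ
                        v , v∈ , w≡ι₂ = ∈-map⁻ ι₂ w∈ʳ
                    in inl≢inr (proj₂ (∈-filter⁻ (λ v → ¬? (v ≟ₘ one)) {xs = elems B} v∈))
                               (trans (sym w≡ι₁) w≡ι₂)

  wedge-downward : ∀ {w w′} → w ∈ wedge-elems → w′ ∣ₘ w → w′ ∈ wedge-elems
  wedge-downward {w′ = w′} w∈ w′∣w with splitAt s w′ | wedge-view w∈
  ... | u′ , v′ , refl | left {u} u∈A refl =
    let u′∣u , v′∣one = Pointwise.++⁻ u′ u w′∣w
    in subst (λ x → u′ Vec.++ x ∈ wedge-elems) (sym (∣one⇒≡one v′∣one))
             (inl∈wedge (downward A u∈A u′∣u))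
  ... | u′ , v′ , refl | right {v} v∈B _ refl with Pointwise.++⁻ u′ one w′∣w
  ...   | u′∣one , v′∣v with ∣one⇒≡one u′∣one | v′ ≟ₘ one
  ...     | refl | yes refl = inl∈wedge (one∈ A)
  ...     | refl | no v′≢one = inr∈wedge (downward B v∈B v′∣v) v′≢one

  _∨_ : OrderIdeal (s + r)
  _∨_ = record
    { elems = wedge-elems
    ; unique = Unique-wedge
    ; nonempty = λ eq → case subst (ι₁ one ∈_) eq (inl∈wedge (one∈ A)) of λ ()
    ; downward = wedge-downward
    }

  private
    ∣-ι₁ : ∀ {u u′} → u ∣ₘ u′ → ι₁ u ∣ₘ ι₁ u′
    ∣-ι₁ u∣u′ = Pointwise.++⁺ u∣u′ ∣-refl

    ∣-ι₂ : ∀ {v v′} → v ∣ₘ v′ → ι₂ v ∣ₘ ι₂ v′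
    ∣-ι₂ v∣v′ = Pointwise.++⁺ (∣-refl {u = one {s}}) v∣v′

  maximal-inl⇒maximal : ∀ {u} → u ∈ elems A → IsMaximal _∨_ (ι₁ u) → IsMaximal A u
  maximal-inl⇒maximal u∈A (_ , max) =
    u∈A , λ u′∈A u∣u′ → ++-injectiveˡ _ _ (max (inl∈wedge u′∈A) (∣-ι₁ u∣u′))

  maximal-inr⇒maximal : ∀ {v} → v ∈ elems B → v ≢ one → IsMaximal _∨_ (ι₂ v) → IsMaximal B v
  maximal-inr⇒maximal v∈B v≢one (_ , max) = v∈B , λ {v′} v′∈B v∣v′ →
    ++-injectiveʳ one one (max (inr∈wedge v′∈B (λ { refl → v≢one (∣one⇒≡one v∣v′) })) (∣-ι₂ v∣v′))

  module _ (pureA : Pure A) (pureB : Pure B) (maxDeg-B : maxDeg B ≡ 0 ⊎ maxDeg B ≡ maxDeg A) where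

    deg-maximal-∨ : ∀ {w} → IsMaximal _∨_ w → deg w ≡ maxDeg A
    deg-maximal-∨ w-max@(w∈ , _) with wedge-view w∈
    ... | left {u} u∈A refl =
      trans (deg-ι₁ u) (Pure⇒deg≡maxDeg A pureA (maximal-inl⇒maximal u∈A w-max))
    ... | right {v} v∈B v≢one refl =
      trans (deg-ι₂ v) (case maxDeg-B of λ
        { (inj₂ maxB≡maxA) → trans deg≡maxB maxB≡maxA
        ; (inj₁ maxB≡0) → contradiction (deg≡0⇒≡one (trans deg≡maxB maxB≡0)) v≢one })
      where
      deg≡maxB : deg v ≡ maxDeg B
      deg≡maxB = Pure⇒deg≡maxDeg B pureB (maximal-inr⇒maximal v∈B v≢one w-max)

    Pure-∨ : Pure _∨_
    Pure-∨ u-max v-max = trans (deg-maximal-∨ u-max) (sym (deg-maximal-∨ v-max))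

  maxDeg-∨ : maxDeg B ≡ 0 ⊎ maxDeg B ≡ maxDeg A → maxDeg _∨_ ≡ maxDeg A
  maxDeg-∨ maxDeg-B = maxDeg-≡ _∨_ bound
    (let u , u∈A , deg≡ = maxDeg-attained A in ι₁ u , inl∈wedge u∈A , trans (deg-ι₁ u) deg≡)
    where
    maxB≤maxA : maxDeg B ≤ maxDeg A
    maxB≤maxA = case maxDeg-B of λ { (inj₁ maxB≡0) → subst (_≤ maxDeg A) (sym maxB≡0) z≤n
                                 ; (inj₂ maxB≡maxA) → ≤-reflexive maxB≡maxA }
    bound : ∀ {w} → w ∈ wedge-elems → deg w ≤ maxDeg A
    bound w∈ with wedge-view w∈
    ... | left {u} u∈A refl = subst (_≤ maxDeg A) (sym (deg-ι₁ u)) (≤maxDeg A u∈A)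
    ... | right {v} v∈B _ refl =
      subst (_≤ maxDeg A) (sym (deg-ι₂ v)) (≤-trans (≤maxDeg B v∈B) maxB≤maxA)

  countDeg-∨ : ∀ k → countDeg _∨_ (suc k) ≡ countDeg A (suc k) + countDeg B (suc k)
  countDeg-∨ k = begin
    countDeg _∨_ (suc k)
      ≡⟨ Unique-⊆⇒length≡ (Unique-layer _∨_ (suc k)) unique-split ⊆split split⊆ ⟩
    length (map ι₁ (layer A (suc k)) ++ map ι₂ (layer B (suc k)))
      ≡⟨ length-++ (map ι₁ (layer A (suc k))) ⟩
    length (map ι₁ (layer A (suc k))) + length (map ι₂ (layer B (suc k)))
      ≡⟨ cong₂ _+_ (length-map ι₁ (layer A (suc k))) (length-map ι₂ (layer B (suc k))) ⟩
    countDeg A (suc k) + countDeg B (suc k)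
      ∎
    where
    open ≡-Reasoning
    nontrivial-layer : ∀ {v} → v ∈ layer B (suc k) → v ≢ one
    nontrivial-layer v∈ refl = contradiction (trans (sym (deg-one {r})) (proj₂ (∈-layer⁻ B v∈))) λ ()
    unique-split : Unique (map ι₁ (layer A (suc k)) ++ map ι₂ (layer B (suc k)))
    unique-split = Unique.++⁺ (Unique.map⁺ (++-injectiveˡ _ _) (Unique-layer A (suc k)))
      (Unique.map⁺ (++-injectiveʳ one one) (Unique-layer B (suc k)))
      λ (w∈ˡ , w∈ʳ) → let _ , _ , w≡inl = ∈-map⁻ ι₁ w∈ˡ
                          _ , v∈ , w≡inr = ∈-map⁻ ι₂ w∈ʳ
                      in inl≢inr (nontrivial-layer v∈) (trans (sym w≡inl) w≡inr)
    ⊆split : ∀ {w} → w ∈ layer _∨_ (suc k) →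
             w ∈ map ι₁ (layer A (suc k)) ++ map ι₂ (layer B (suc k))
    ⊆split w∈ with ∈-layer⁻ _∨_ w∈
    ... | w∈∨ , deg≡ with wedge-view w∈∨
    ...   | left {u} u∈A refl = ∈-++⁺ˡ (∈-map⁺ ι₁ (∈-layer⁺ A u∈A (trans (sym (deg-ι₁ u)) deg≡)))
    ...   | right {v} v∈B _ refl =
      ∈-++⁺ʳ (map ι₁ (layer A (suc k))) (∈-map⁺ ι₂ (∈-layer⁺ B v∈B (trans (sym (deg-ι₂ v)) deg≡)))
    split⊆ : ∀ {w} → w ∈ map ι₁ (layer A (suc k)) ++ map ι₂ (layer B (suc k)) →
             w ∈ layer _∨_ (suc k)
    split⊆ w∈ with ∈-++⁻ (map ι₁ (layer A (suc k))) w∈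
    ... | inj₁ w∈ˡ = let u , u∈ , w≡ = ∈-map⁻ ι₁ w∈ˡ
                         u∈A , deg≡ = ∈-layer⁻ A u∈
                     in subst (_∈ layer _∨_ (suc k)) (sym w≡)
                          (∈-layer⁺ _∨_ (inl∈wedge u∈A) (trans (deg-ι₁ u) deg≡))
    ... | inj₂ w∈ʳ = let v , v∈ , w≡ = ∈-map⁻ ι₂ w∈ʳ
                         v∈B , deg≡ = ∈-layer⁻ B v∈
                     in subst (_∈ layer _∨_ (suc k)) (sym w≡)
                          (∈-layer⁺ _∨_ (inr∈wedge v∈B (nontrivial-layer v∈)) (trans (deg-ι₂ v) deg≡))

-- Sufficiency

countDeg-principal : ∀ {m : Monomial s} {k} (us : List (Monomial s)) → Unique us →
  (∀ {u} → u ∣ₘ m → deg u ≡ k → u ∈ us) → (∀ {u} → u ∈ us → u ∣ₘ m × deg u ≡ k) →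
  countDeg (principal m) k ≡ length us
countDeg-principal {m = m} us !us complete sound = Unique-⊆⇒length≡ (Unique-layer (principal m) _) !us
  (λ u∈ → let u∈div , deg≡ = ∈-layer⁻ (principal m) u∈ in complete (∈-divisors⁻ m u∈div) deg≡)
  (λ u∈us → let u∣m , deg≡ = sound u∈us in ∈-layer⁺ (principal m) (∈-divisors⁺ u∣m) deg≡)

power : ℕ → OrderIdeal 1
power m = principal (suc m ∷ [])

hook : ℕ → OrderIdeal 2
hook m = principal (1 ∷ m ∷ [])

maxDeg-power : ∀ m → maxDeg (power m) ≡ suc m
maxDeg-power m = trans (maxDeg-principal (suc m ∷ [])) (cong suc (+-identityʳ m))

maxDeg-hook : ∀ m → maxDeg (hook m) ≡ suc m
maxDeg-hook m = trans (maxDeg-principal (1 ∷ m ∷ [])) (cong suc (+-identityʳ m))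

countDeg-power : ∀ m i → i ≤ m → countDeg (power m) (suc i) ≡ 1
countDeg-power m i i≤m = countDeg-principal ((suc i ∷ []) ∷ []) (All.[] AllPairs.∷ AllPairs.[])
  (λ { {x ∷ []} _ deg≡ → here (cong (_∷ []) (trans (sym (+-identityʳ x)) deg≡)) })
  λ { (here refl) → s≤s i≤m ∷ [] , cong suc (+-identityʳ i) }

countDeg-hook-inner : ∀ m i → i < m → countDeg (hook m) (suc i) ≡ 2
countDeg-hook-inner m i i<m = countDeg-principal
  ((0 ∷ suc i ∷ []) ∷ (1 ∷ i ∷ []) ∷ [])
  (((λ ()) All.∷ All.[]) AllPairs.∷ All.[] AllPairs.∷ AllPairs.[])
  complete λ { (here refl) → z≤n ∷ i<m ∷ [] , cong suc (+-identityʳ i)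
             ; (there (here refl)) → s≤s z≤n ∷ <⇒≤ i<m ∷ [] , cong suc (+-identityʳ i) }
  where
  complete : ∀ {u} → u ∣ₘ (1 ∷ m ∷ []) → deg u ≡ suc i → u ∈ (0 ∷ suc i ∷ []) ∷ (1 ∷ i ∷ []) ∷ []
  complete {0 ∷ y ∷ []} _ deg≡ = here (cong (λ z → 0 ∷ z ∷ []) (trans (sym (+-identityʳ y)) deg≡))
  complete {1 ∷ y ∷ []} _ deg≡ =
    there (here (cong (λ z → 1 ∷ z ∷ []) (suc-injective (trans (cong suc (sym (+-identityʳ y))) deg≡))))
  complete {suc (suc x) ∷ y ∷ []} (s≤s () ∷ _) _

countDeg-hook-top : ∀ m → countDeg (hook m) (suc m) ≡ 1
countDeg-hook-top m = countDeg-principal ((1 ∷ m ∷ []) ∷ []) (All.[] AllPairs.∷ AllPairs.[])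
  complete λ { (here refl) → s≤s z≤n ∷ ≤-refl ∷ [] , cong suc (+-identityʳ m) }
  where
  complete : ∀ {u} → u ∣ₘ (1 ∷ m ∷ []) → deg u ≡ suc m → u ∈ (1 ∷ m ∷ []) ∷ []
  complete {0 ∷ y ∷ []} (_ ∷ y≤m ∷ []) deg≡ =
    contradiction (subst (_≤ m) (trans (sym (+-identityʳ y)) deg≡) y≤m) (<⇒≱ ≤-refl)
  complete {1 ∷ y ∷ []} _ deg≡ =
    here (cong (λ z → 1 ∷ z ∷ []) (suc-injective (trans (cong suc (sym (+-identityʳ y))) deg≡)))
  complete {suc (suc x) ∷ y ∷ []} (s≤s () ∷ _) _

unit : OrderIdeal 0
unit = principal []

-- maxDeg A ≡ 0 means that A = {1}, the unit of ∨.
PureOrUnit : ℕ → OrderIdeal s → Set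
PureOrUnit n A = Pure A × (maxDeg A ≡ 0 ⊎ maxDeg A ≡ n)

wedgeCopies : ℕ → Σ ℕ OrderIdeal → Σ ℕ OrderIdeal → Σ ℕ OrderIdeal
wedgeCopies zero _ Y = Y
wedgeCopies (suc k) X Y = _ , proj₂ X ∨ proj₂ (wedgeCopies k X Y)

module _ {s : ℕ} (A : OrderIdeal s) where

  PureOrUnit-wedgeCopies : ∀ {n} → Pure A → maxDeg A ≡ n → ∀ k {t} {B : OrderIdeal t} → PureOrUnit n B →
                           PureOrUnit n (proj₂ (wedgeCopies k (s , A) (t , B)))
  PureOrUnit-wedgeCopies pureA maxA≡n zero pureB = pureB
  PureOrUnit-wedgeCopies pureA refl (suc k) {t} {B} pureB with PureOrUnit-wedgeCopies pureA refl k pureB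
  ... | pureC , maxDeg-C = Pure-∨ A C pureA pureC maxDeg-C , inj₂ (maxDeg-∨ A C maxDeg-C)
    where
    C : OrderIdeal (proj₁ (wedgeCopies k (s , A) (t , B)))
    C = proj₂ (wedgeCopies k (s , A) (t , B))

  countDeg-wedgeCopies : ∀ k Y i → countDeg (proj₂ (wedgeCopies k (s , A) Y)) (suc i) ≡
                                   k * countDeg A (suc i) + countDeg (proj₂ Y) (suc i)
  countDeg-wedgeCopies zero Y i = refl
  countDeg-wedgeCopies (suc k) Y i = begin
    countDeg (proj₂ (wedgeCopies (suc k) (s , A) Y)) (suc i)
      ≡⟨ countDeg-∨ A (proj₂ (wedgeCopies k (s , A) Y)) i ⟩
    countDeg A (suc i) + countDeg (proj₂ (wedgeCopies k (s , A) Y)) (suc i)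
      ≡⟨ cong (countDeg A (suc i) +_) (countDeg-wedgeCopies k Y i) ⟩
    countDeg A (suc i) + (k * countDeg A (suc i) + countDeg (proj₂ Y) (suc i))
      ≡⟨ +-assoc (countDeg A (suc i)) _ _ ⟨
    suc k * countDeg A (suc i) + countDeg (proj₂ Y) (suc i) ∎
    where open ≡-Reasoning

countDeg>0⇒≤maxDeg : ∀ (A : OrderIdeal s) k → 0 < countDeg A k → k ≤ maxDeg A
countDeg>0⇒≤maxDeg A k 0<count with length>0⇒∈ (layer A k) 0<count
... | u , u∈ = let u∈A , deg≡k = ∈-layer⁻ A u∈ in subst (_≤ maxDeg A) deg≡k (≤maxDeg A u∈A)

hooksAndPowers : ℕ → ℕ → ℕ → Σ ℕ OrderIdeal
hooksAndPowers m p q = wedgeCopies p (2 , hook m) (wedgeCopies q (1 , power m) (0 , unit))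

module _ (m p q : ℕ) where

  private
    ideal : OrderIdeal (proj₁ (hooksAndPowers m p q))
    ideal = proj₂ (hooksAndPowers m p q)

  PureOrUnit-hooksAndPowers : PureOrUnit (suc m) ideal
  PureOrUnit-hooksAndPowers = PureOrUnit-wedgeCopies (hook m) (Pure-principal (1 ∷ m ∷ [])) (maxDeg-hook m) p
    (PureOrUnit-wedgeCopies (power m) (Pure-principal (suc m ∷ [])) (maxDeg-power m) q
      (Pure-principal [] , inj₁ (maxDeg-principal [])))

  countDeg-hooksAndPowers : ∀ i → countDeg ideal (suc i) ≡
                            p * countDeg (hook m) (suc i) + (q * countDeg (power m) (suc i) + 0)
  countDeg-hooksAndPowers i = trans (countDeg-wedgeCopies (hook m) p _ i)
    (cong (p * countDeg (hook m) (suc i) +_) (countDeg-wedgeCopies (power m) q _ i))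

  countDeg-hooksAndPowers-inner : ∀ i → i < m → countDeg ideal (suc i) ≡ p + (p + q)
  countDeg-hooksAndPowers-inner i i<m = begin
    countDeg ideal (suc i)                                                 ≡⟨ countDeg-hooksAndPowers i ⟩
    p * countDeg (hook m) (suc i) + (q * countDeg (power m) (suc i) + 0)
      ≡⟨ cong₂ (λ x y → p * x + (q * y + 0)) (countDeg-hook-inner m i i<m) (countDeg-power m i (<⇒≤ i<m)) ⟩
    p * 2 + (q * 1 + 0)                                                    ≡⟨ normalise p q ⟩
    p + (p + q)                                                            ∎
    where
    open ≡-Reasoning
    normalise : ∀ p q → p * 2 + (q * 1 + 0) ≡ p + (p + q)
    normalise = solve-∀

  countDeg-hooksAndPowers-top : countDeg ideal (suc m) ≡ p + q
  countDeg-hooksAndPowers-top = begin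
    countDeg ideal (suc m)                                                 ≡⟨ countDeg-hooksAndPowers m ⟩
    p * countDeg (hook m) (suc m) + (q * countDeg (power m) (suc m) + 0)
      ≡⟨ cong₂ (λ x y → p * x + (q * y + 0)) (countDeg-hook-top m) (countDeg-power m m ≤-refl) ⟩
    p * 1 + (q * 1 + 0)                                                    ≡⟨ normalise p q ⟩
    p + q                                                                  ∎
    where
    open ≡-Reasoning
    normalise : ∀ p q → p * 1 + (q * 1 + 0) ≡ p + q
    normalise = solve-∀

  hVector-hooksAndPowers : 0 < p + q → hVector ideal ≡ 1 ∷ replicate m (p + (p + q)) ++ (p + q) ∷ []
  hVector-hooksAndPowers 0<p+q = Equivalence.from (hVector≡⇔ ideal m _ _)
    (maxDeg≡ , countDeg-hooksAndPowers-inner , countDeg-hooksAndPowers-top)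
    where
    maxDeg≡ : maxDeg ideal ≡ suc m
    maxDeg≡ with proj₂ PureOrUnit-hooksAndPowers
    ... | inj₂ maxDeg≡suc-m = maxDeg≡suc-m
    ... | inj₁ maxDeg≡0 = contradiction (subst (suc m ≤_) maxDeg≡0
      (countDeg>0⇒≤maxDeg ideal (suc m) (subst (0 <_) (sym countDeg-hooksAndPowers-top) 0<p+q))) λ ()

bounds⇒pureOSequence : ∀ m {a b} → 0 < b → b ≤ a → a ≤ 2 * b →
                       PureOSequence (1 ∷ replicate m a ++ b ∷ [])
bounds⇒pureOSequence m {a} {b} 0<b b≤a a≤2b =
  positive , _ , proj₂ (hooksAndPowers m p q) , proj₁ (PureOrUnit-hooksAndPowers m p q) ,
  subst₂ (λ x y → hVector (proj₂ (hooksAndPowers m p q)) ≡ 1 ∷ replicate m x ++ y ∷ []) p+[p+q]≡a p+q≡b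
    (hVector-hooksAndPowers m p q (subst (0 <_) (sym p+q≡b) 0<b))
  where
  p q : ℕ
  p = a ∸ b
  q = b ∸ p
  p+q≡b : p + q ≡ b
  p+q≡b = m+[n∸m]≡n (m≤n+o⇒m∸n≤o a b (subst (a ≤_) (cong (b +_) (+-identityʳ b)) a≤2b))
  p+[p+q]≡a : p + (p + q) ≡ a
  p+[p+q]≡a = trans (cong (p +_) p+q≡b) (m∸n+n≡m b≤a)
  positive : All (0 <_) (1 ∷ replicate m a ++ b ∷ [])
  positive = s≤s z≤n ∷ All.++⁺ (All.replicate⁺ m (<-≤-trans 0<b b≤a)) (0<b ∷ [])

-- Necessity

pairs : List (Fin s) → List (Monomial s)
pairs [] = []
pairs (i ∷ is) = map (λ j → var i · var j) is ++ pairs is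

∈-pairs⁻ : ∀ {is : List (Fin s)} {z} → Unique is → z ∈ pairs is →
           ∃₂ λ i j → i ∈ is × j ∈ is × i ≢ j × z ≡ var i · var j
∈-pairs⁻ {is = i ∷ is} (i∉is ∷ !is) z∈ with ∈-++⁻ (map (λ j → var i · var j) is) z∈
... | inj₁ z∈ˡ = let j , j∈ , z≡ = ∈-map⁻ (λ j → var i · var j) z∈ˡ
                 in i , j , here refl , there j∈ , (All.lookup i∉is j∈) , z≡
... | inj₂ z∈ʳ = let i′ , j , i′∈ , j∈ , i′≢j , z≡ = ∈-pairs⁻ !is z∈ʳ
                 in i′ , j , there i′∈ , there j∈ , i′≢j , z≡

Unique-pairs : ∀ {is : List (Fin s)} → Unique is → Unique (pairs is)
Unique-pairs {is = []} _ = Unique.[]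
Unique-pairs {is = i ∷ is} (i∉is ∷ !is) =
  Unique.++⁺ (Unique.map⁺ (λ eq → var-injective (·-cancelˡ (var i) eq)) !is) (Unique-pairs !is) disjoint
  where
  disjoint : ∀ {z} → ¬ (z ∈ map (λ j → var i · var j) is × z ∈ pairs is)
  disjoint (z∈ˡ , z∈ʳ) with ∈-map⁻ (λ j → var i · var j) z∈ˡ | ∈-pairs⁻ !is z∈ʳ
  ... | j , _ , refl | k , l , k∈ , l∈ , _ , eq with var·var-injective eq
  ...   | inj₁ (refl , _) = All.lookup i∉is k∈ refl
  ...   | inj₂ (refl , _) = All.lookup i∉is l∈ refl

HasSquare : Monomial s → Set
HasSquare t = ∃ λ i → 2 ≤ lookup t i

hasSquare? : ∀ (t : Monomial s) → Dec (HasSquare t)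
hasSquare? t = any? (λ i → 2 ≤? lookup t i)

¬HasSquare⇒Squarefree : ∀ {t : Monomial s} → ¬ HasSquare t → Squarefree t
¬HasSquare⇒Squarefree ¬sq i = ≤-pred (≰⇒> λ 2≤tᵢ → ¬sq (i , 2≤tᵢ))

HasSquare⇒¬Squarefree : ∀ {t : Monomial s} → HasSquare t → ¬ Squarefree t
HasSquare⇒¬Squarefree (i , 2≤tᵢ) sf = <⇒≱ 2≤tᵢ (sf i)

module TopShape {s : ℕ} (A : OrderIdeal s) (pureA : Pure A) {m : ℕ} (3≤m : 3 ≤ m)
                (maxDeg≡ : maxDeg A ≡ suc m) (h₂≤h₁ : countDeg A 2 ≤ countDeg A 1) where

  open import Data.List.Membership.DecPropositional (_≟ₘ_ {s}) using (_∈?_)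

  Tops : List (Monomial s)
  Tops = layer A (suc m)

  top∈ : ∀ {t} → t ∈ Tops → t ∈ elems A
  top∈ t∈ = proj₁ (∈-layer⁻ A t∈)

  deg-top : ∀ {t} → t ∈ Tops → deg t ≡ suc m
  deg-top t∈ = proj₂ (∈-layer⁻ A t∈)

  ∣-top : ∀ {u} → u ∈ elems A → ∃ λ t → t ∈ Tops × u ∣ₘ t
  ∣-top u∈A with ∣-maximal A u∈A
  ... | t , t-max , u∣t =
    t , ∈-layer⁺ A (proj₁ t-max) (trans (Pure⇒deg≡maxDeg A pureA t-max) maxDeg≡) , u∣t

  Vars : List (Fin s)
  Vars = filter (λ x → var x ∈? elems A) (allFin s)

  Unique-Vars : Unique Vars
  Unique-Vars = Unique.filter⁺ (λ x → var x ∈? elems A) (Unique.allFin⁺ s)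

  Loop : Fin s → Set
  Loop x = var x · var x ∈ elems A

  -- Two variables that were each other's partners via squarefreeTop would both pick the same first top,
  -- where the rotation has no 2-cycles; no other pair of cases can be symmetric.  Hence link is injective.
  data Partner (x : Fin s) : Fin s → Set where
    loop : Loop x → Partner x x
    square : ∀ {y} → ¬ Loop x → Loop y → var x · var y ∈ elems A → Partner x y
    squarefreeTop : ∀ {y t} → ¬ Loop x → (∀ {t′} → t′ ∈ Tops → var x ∣ₘ t′ → Squarefree t′) →
                    findFirst (var x ∣?_) Tops ≡ just t → y ≡ rotate _≟ᶠ_ (supp t) x → Partner x y
    isolated : findFirst (var x ∣?_) Tops ≡ nothing → Partner x x

  partner : ∀ x → ∃ (Partner x)
  partner x with var x · var x ∈? elems A
  ... | yes ℓ = x , loop ℓ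
  ... | no ¬ℓ with Any.any? (λ t → (var x ∣? t) ×-dec hasSquare? t) Tops
  ...   | yes found with find found
  ...     | t , t∈ , x∣t , y , 2≤tᵧ =
    y , square ¬ℓ ℓ-y (downward A (top∈ t∈) (var·var∣ x≢y (var∣⇒ x∣t) 1≤tᵧ))
    where
    ℓ-y : Loop y
    ℓ-y = downward A (top∈ t∈) (var²∣ 2≤tᵧ)
    x≢y : x ≢ y
    x≢y refl = ¬ℓ ℓ-y
    1≤tᵧ : 1 ≤ lookup t y
    1≤tᵧ = ≤-trans (s≤s z≤n) 2≤tᵧ
  partner x | no ¬ℓ | no noSquare with findFirst (var x ∣?_) Tops in first≡
  ... | just t = rotate _≟ᶠ_ (supp t) x , squarefreeTop ¬ℓ squarefree first≡ refl
    where
    squarefree : ∀ {t′} → t′ ∈ Tops → var x ∣ₘ t′ → Squarefree t′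
    squarefree {t′} t′∈ x∣t′ =
      ¬HasSquare⇒Squarefree {t = t′} λ sq → noSquare (Any.map (λ { refl → x∣t′ , sq }) t′∈)
  ... | nothing = x , isolated first≡

  mate : Fin s → Fin s
  mate x = proj₁ (partner x)

  link : Fin s → Monomial s
  link x = var x · var (mate x)

  ∈Vars⇒var∈ : ∀ {x} → x ∈ Vars → var x ∈ elems A
  ∈Vars⇒var∈ x∈ = proj₂ (∈-filter⁻ (λ x → var x ∈? elems A) {xs = allFin s} x∈)

  var∈⇒∈Vars : ∀ {x} → var x ∈ elems A → x ∈ Vars
  var∈⇒∈Vars {x} x∈A = ∈-filter⁺ (λ x → var x ∈? elems A) (∈-allFin x) x∈A

  ¬isolated : ∀ {x} → x ∈ Vars → findFirst (var x ∣?_) Tops ≢ nothing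
  ¬isolated {x} x∈ none with ∣-top (∈Vars⇒var∈ x∈)
  ... | t , t∈ , x∣t = findFirst-nothing (var x ∣?_) Tops none t∈ x∣t

  deg-var·var : ∀ (x y : Fin s) → deg (var x · var y) ≡ 2
  deg-var·var x y = trans (deg-· (var x) (var y)) (cong₂ _+_ (deg-var x) (deg-var y))

  module _ {x t} (first≡ : findFirst (var x ∣?_) Tops ≡ just t)
           (squarefree : ∀ {t′} → t′ ∈ Tops → var x ∣ₘ t′ → Squarefree t′) where

    first∈Tops : t ∈ Tops
    first∈Tops = proj₁ (findFirst-just (var x ∣?_) Tops first≡)

    var∣first : var x ∣ₘ t
    var∣first = proj₂ (findFirst-just (var x ∣?_) Tops first≡)

    Distinct₃-supp-first : Distinct₃ _≟ᶠ_ (supp t)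
    Distinct₃-supp-first = Unique⇒Distinct₃ _≟ᶠ_ (Unique-supp t) (begin
      3            ≤⟨ m≤n⇒m≤1+n 3≤m ⟩
      suc m        ≡⟨ deg-top first∈Tops ⟨
      deg t        ≤⟨ deg≤length-supp t (squarefree first∈Tops var∣first) ⟩
      length (supp t) ∎)
      where open ≤-Reasoning

    rotate∣first : ∀ {y} → y ≡ rotate _≟ᶠ_ (supp t) x → var y ∣ₘ t
    rotate∣first refl = ⇒var∣ (∈-supp⁻ t (rotate-∈ _≟ᶠ_ Distinct₃-supp-first x))

  Partner⇒∈ : ∀ {x y} → x ∈ Vars → Partner x y → var x · var y ∈ elems A
  Partner⇒∈ _ (loop ℓ) = ℓ
  Partner⇒∈ _ (square _ _ xy∈A) = xy∈A
  Partner⇒∈ {x} {y} _ (squarefreeTop _ squarefree first≡ y≡) =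
    downward A (top∈ (first∈Tops first≡ squarefree))
      (var·var∣ x≢y (var∣⇒ (var∣first first≡ squarefree)) (var∣⇒ (rotate∣first first≡ squarefree y≡)))
    where
    x≢y : x ≢ y
    x≢y x≡y = rotate-≢ _≟ᶠ_ (Distinct₃-supp-first first≡ squarefree) x (sym (trans x≡y y≡))
  Partner⇒∈ x∈ (isolated none) = contradiction none (¬isolated x∈)

  link∈layer₂ : ∀ {x} → x ∈ Vars → link x ∈ layer A 2
  link∈layer₂ {x} x∈ = ∈-layer⁺ A (Partner⇒∈ x∈ (proj₂ (partner x))) (deg-var·var x (mate x))

  Partner-symmetric⇒≡ : ∀ {x y} → Partner x y → Partner y x → x ≡ y
  Partner-symmetric⇒≡ (loop _) _ = refl
  Partner-symmetric⇒≡ (isolated _) _ = refl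
  Partner-symmetric⇒≡ _ (loop _) = refl
  Partner-symmetric⇒≡ _ (isolated _) = refl
  Partner-symmetric⇒≡ (square _ ℓy _) (square ¬ℓy _ _) = contradiction ℓy ¬ℓy
  Partner-symmetric⇒≡ (square _ ℓy _) (squarefreeTop ¬ℓy _ _ _) = contradiction ℓy ¬ℓy
  Partner-symmetric⇒≡ (squarefreeTop ¬ℓx _ _ _) (square _ ℓx _) = contradiction ℓx ¬ℓx
  Partner-symmetric⇒≡ {x} {y} (squarefreeTop {t = t} _ sfx firstx y≡)
                              (squarefreeTop {t = t′} _ sfy firsty x≡) =
    contradiction (sym x≡′) (rotate-rotate-≢ _≟ᶠ_ (Distinct₃-supp-first firstx sfx) x)
    where
    t≡t′ : t ≡ t′
    t≡t′ = findFirst-≡ (var x ∣?_) (var y ∣?_) Tops firstx firsty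
             (rotate∣first firstx sfx y≡) (rotate∣first firsty sfy x≡)
    x≡′ : x ≡ rotate _≟ᶠ_ (supp t) (rotate _≟ᶠ_ (supp t) x)
    x≡′ = trans x≡ (trans (cong (λ u → rotate _≟ᶠ_ (supp u) y) (sym t≡t′))
                          (cong (rotate _≟ᶠ_ (supp t)) y≡))

  link-injective : ∀ {x x′} → link x ≡ link x′ → x ≡ x′
  link-injective {x} {x′} eq with var·var-injective eq
  ... | inj₁ (x≡x′ , _) = x≡x′
  ... | inj₂ (x≡mate′ , mate≡x′) = Partner-symmetric⇒≡
    (subst (Partner x) mate≡x′ (proj₂ (partner x)))
    (subst (Partner x′) (sym x≡mate′) (proj₂ (partner x′)))

  countDeg₁≤length-Vars : countDeg A 1 ≤ length Vars
  countDeg₁≤length-Vars = subst (countDeg A 1 ≤_) (length-map var Vars)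
    (Unique-⊆⇒length≤ (Unique-layer A 1) layer₁⊆)
    where
    layer₁⊆ : ∀ {u} → u ∈ layer A 1 → u ∈ map var Vars
    layer₁⊆ {u} u∈ with ∈-layer⁻ A u∈
    ... | u∈A , deg≡1 with deg≡1⇒var {t = u} deg≡1
    ...   | x , u≡var = subst (_∈ map var Vars) (sym u≡var)
                          (∈-map⁺ var (var∈⇒∈Vars (subst (_∈ elems A) u≡var u∈A)))

  layer₂⊆links : ∀ {z} → z ∈ layer A 2 → z ∈ map link Vars
  layer₂⊆links = Unique-⊆⇒⊇ _≟ₘ_ (Unique.map⁺ link-injective Unique-Vars) links⊆
    (≤-trans h₂≤h₁ (subst (countDeg A 1 ≤_) (sym (length-map link Vars)) countDeg₁≤length-Vars))
    where
    links⊆ : ∀ {z} → z ∈ map link Vars → z ∈ layer A 2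
    links⊆ z∈ with ∈-map⁻ link z∈
    ... | x , x∈ , refl = link∈layer₂ x∈

  edge-linked : ∀ {i j} → var i · var j ∈ elems A → mate i ≡ j ⊎ mate j ≡ i
  edge-linked {i} {j} ij∈A with ∈-map⁻ link (layer₂⊆links (∈-layer⁺ A ij∈A (deg-var·var i j)))
  ... | u , _ , eq with var·var-injective eq
  ...   | inj₁ (refl , j≡mate) = inj₁ (sym j≡mate)
  ...   | inj₂ (i≡mate , refl) = inj₂ (sym i≡mate)

  edge⇒Partner : ∀ {i j} → var i · var j ∈ elems A → Partner i j ⊎ Partner j i
  edge⇒Partner {i} {j} ij∈A with edge-linked ij∈A
  ... | inj₁ mate≡j = inj₁ (subst (Partner i) mate≡j (proj₂ (partner i)))
  ... | inj₂ mate≡i = inj₂ (subst (Partner j) mate≡i (proj₂ (partner j)))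

  Loop-Partner⇒≡ : ∀ {x y} → Loop x → Partner x y → x ≡ y
  Loop-Partner⇒≡ _ (loop _) = refl
  Loop-Partner⇒≡ ℓ (square ¬ℓ _ _) = contradiction ℓ ¬ℓ
  Loop-Partner⇒≡ ℓ (squarefreeTop ¬ℓ _ _ _) = contradiction ℓ ¬ℓ
  Loop-Partner⇒≡ _ (isolated _) = refl

  loops-nonadjacent : ∀ {x y} → x ≢ y → Loop x → Loop y → var x · var y ∉ elems A
  loops-nonadjacent x≢y ℓx ℓy xy∈A with edge⇒Partner xy∈A
  ... | inj₁ xy = x≢y (Loop-Partner⇒≡ ℓx xy)
  ... | inj₂ yx = x≢y (sym (Loop-Partner⇒≡ ℓy yx))

  module _ {t} (t∈ : t ∈ Tops) (square-in-t : HasSquare t) where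

    nonloop-Partner⇒≡ : ∀ {x y} → ¬ Loop x → ¬ Loop y → var x ∣ₘ t → Partner x y → x ≡ y
    nonloop-Partner⇒≡ ¬ℓx _ _ (loop ℓx) = contradiction ℓx ¬ℓx
    nonloop-Partner⇒≡ _ ¬ℓy _ (square _ ℓy _) = contradiction ℓy ¬ℓy
    nonloop-Partner⇒≡ _ _ x∣t (squarefreeTop _ squarefree _ _) =
      contradiction (squarefree t∈ x∣t) (HasSquare⇒¬Squarefree {t = t} square-in-t)
    nonloop-Partner⇒≡ _ _ _ (isolated _) = refl

    nonloops-nonadjacent : ∀ {x y} → x ≢ y → ¬ Loop x → ¬ Loop y → var x ∣ₘ t → var y ∣ₘ t →
                           var x · var y ∉ elems A
    nonloops-nonadjacent x≢y ¬ℓx ¬ℓy x∣t y∣t xy∈A with edge⇒Partner xy∈A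
    ... | inj₁ xy = x≢y (nonloop-Partner⇒≡ ¬ℓx ¬ℓy x∣t xy)
    ... | inj₂ yx = x≢y (sym (nonloop-Partner⇒≡ ¬ℓy ¬ℓx y∣t yx))

  no-four-pairwise-adjacent : ∀ {a b c d} → Unique (a ∷ b ∷ c ∷ d ∷ []) →
    (∀ {i j} → i ∈ a ∷ b ∷ c ∷ d ∷ [] → j ∈ a ∷ b ∷ c ∷ d ∷ [] → i ≢ j → var i · var j ∈ elems A) →
    ⊥
  no-four-pairwise-adjacent {a} {b} {c} {d} !Q adjacent =
    contradiction (Unique-⊆⇒length≤ (Unique-pairs !Q) pairs⊆links) λ { (s≤s (s≤s (s≤s (s≤s ())))) }
    where
    Q : List (Fin s)
    Q = a ∷ b ∷ c ∷ d ∷ []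
    pairs⊆links : ∀ {z} → z ∈ pairs Q → z ∈ map link Q
    pairs⊆links z∈ with ∈-pairs⁻ !Q z∈
    ... | i , j , i∈ , j∈ , i≢j , refl with edge-linked (adjacent i∈ j∈ i≢j)
    ...   | inj₁ mate≡j = subst (_∈ map link Q) (cong (λ y → var i · var y) mate≡j) (∈-map⁺ link i∈)
    ...   | inj₂ mate≡i = subst (_∈ map link Q)
                            (trans (cong (λ y → var j · var y) mate≡i) (·-comm (var j) (var i)))
                            (∈-map⁺ link j∈)

  no-squarefree-top : ∀ {t} → t ∈ Tops → ¬ Squarefree t
  no-squarefree-top {t} t∈ squarefree = four-in-support (supp t) (Unique-supp t) (∈-supp⁻ t)
    (≤-trans (s≤s 3≤m) (subst (_≤ length (supp t)) (deg-top t∈) (deg≤length-supp t squarefree)))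
    where
    four-in-support : ∀ xs → Unique xs → (∀ {i} → i ∈ xs → 1 ≤ lookup t i) → 4 ≤ length xs → ⊥
    four-in-support (a ∷ b ∷ c ∷ d ∷ rest) !xs positive _ = no-four-pairwise-adjacent (Unique.take⁺ 4 !xs)
      λ i∈ j∈ i≢j → downward A (top∈ t∈)
        (var·var∣ i≢j (positive (∈-++⁺ˡ {ys = rest} i∈)) (positive (∈-++⁺ˡ {ys = rest} j∈)))
    four-in-support [] _ _ ()
    four-in-support (_ ∷ []) _ _ (s≤s ())
    four-in-support (_ ∷ _ ∷ []) _ _ (s≤s (s≤s ()))
    four-in-support (_ ∷ _ ∷ _ ∷ []) _ _ (s≤s (s≤s (s≤s ())))

  module _ {t w} (t∈ : t ∈ Tops) (2≤tw : 2 ≤ lookup t w) where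

    private
      ℓw : Loop w
      ℓw = downward A (top∈ t∈) (var²∣ 2≤tw)
      1≤tw : 1 ≤ lookup t w
      1≤tw = ≤-trans (s≤s z≤n) 2≤tw
      adjacent : ∀ {a b} → a ≢ b → 1 ≤ lookup t a → 1 ≤ lookup t b → var a · var b ∈ elems A
      adjacent a≢b 1≤ta 1≤tb = downward A (top∈ t∈) (var·var∣ a≢b 1≤ta 1≤tb)

    no-second-square : ∀ {k} → k ≢ w → ¬ (2 ≤ lookup t k)
    no-second-square k≢w 2≤tk =
      loops-nonadjacent (≢-sym k≢w) ℓw (downward A (top∈ t∈) (var²∣ 2≤tk))
        (adjacent (≢-sym k≢w) 1≤tw (≤-trans (s≤s z≤n) 2≤tk))

    no-two-further-vars : ∀ {a b} → a ≢ b → a ≢ w → b ≢ w → 1 ≤ lookup t a → 1 ≤ lookup t b → ⊥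
    no-two-further-vars {a} {b} a≢b a≢w b≢w 1≤ta 1≤tb
      with var a · var a ∈? elems A | var b · var b ∈? elems A
    ... | yes ℓa | _ = loops-nonadjacent (≢-sym a≢w) ℓw ℓa (adjacent (≢-sym a≢w) 1≤tw 1≤ta)
    ... | no _ | yes ℓb = loops-nonadjacent (≢-sym b≢w) ℓw ℓb (adjacent (≢-sym b≢w) 1≤tw 1≤tb)
    ... | no ¬ℓa | no ¬ℓb =
      nonloops-nonadjacent t∈ (w , 2≤tw) a≢b ¬ℓa ¬ℓb (⇒var∣ 1≤ta) (⇒var∣ 1≤tb) (adjacent a≢b 1≤ta 1≤tb)

    private
      rest : Monomial s
      rest = t [ w ]≔ 0
      lookup-rest : ∀ {k} → k ≢ w → lookup rest k ≡ lookup t k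
      lookup-rest k≢w = lookup∘update′ k≢w t 0

    square-exponent≥ : m ≤ lookup t w
    square-exponent≥ with m ≤? lookup t w
    ... | yes m≤tw = m≤tw
    ... | no m≰tw with hasSquare? rest
    ...   | yes (k , 2≤rk) =
      contradiction (subst (2 ≤_) (lookup-rest (≢w 2≤rk)) 2≤rk) (no-second-square (≢w 2≤rk))
      where
      ≢w : ∀ {k} → 2 ≤ lookup rest k → k ≢ w
      ≢w 2≤rk refl = contradiction (subst (2 ≤_) (lookup∘update w t 0) 2≤rk) λ ()
    ...   | no ¬sq = ⊥-elim (two-in-support (supp rest) (Unique-supp rest) (∈-supp⁻ rest)
                       (≤-trans 2≤deg-rest (deg≤length-supp rest (¬HasSquare⇒Squarefree {t = rest} ¬sq))))
      where
      2≤deg-rest : 2 ≤ deg rest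
      2≤deg-rest = +-cancelˡ-≤ (lookup t w) 2 (deg rest) (begin
        lookup t w + 2               ≡⟨ +-comm (lookup t w) 2 ⟩
        suc (suc (lookup t w))       ≤⟨ s≤s (≰⇒> m≰tw) ⟩
        suc m                        ≡⟨ deg-top t∈ ⟨
        deg t                        ≡⟨ deg-[]≔0 t w ⟩
        lookup t w + deg rest        ∎)
        where open ≤-Reasoning
      ≢w : ∀ {k} → 1 ≤ lookup rest k → k ≢ w
      ≢w 1≤rk refl = contradiction (subst (1 ≤_) (lookup∘update w t 0) 1≤rk) λ ()
      two-in-support : ∀ xs → Unique xs → (∀ {i} → i ∈ xs → 1 ≤ lookup rest i) → 2 ≤ length xs → ⊥
      two-in-support (a ∷ b ∷ _) ((a≢b All.∷ _) ∷ _) positive _ =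
        no-two-further-vars a≢b (≢w 1≤ra) (≢w 1≤rb)
        (subst (1 ≤_) (lookup-rest (≢w 1≤ra)) 1≤ra) (subst (1 ≤_) (lookup-rest (≢w 1≤rb)) 1≤rb)
        where
        1≤ra : 1 ≤ lookup rest a
        1≤ra = positive (here refl)
        1≤rb : 1 ≤ lookup rest b
        1≤rb = positive (there (here refl))
      two-in-support [] _ _ ()
      two-in-support (_ ∷ []) _ _ (s≤s ())

  top-shape : ∀ {t} → t ∈ Tops → ∃ λ w → m ≤ lookup t w
  top-shape {t} t∈ with hasSquare? t
  ... | yes (w , 2≤tw) = w , square-exponent≥ t∈ 2≤tw
  ... | no ¬sq = contradiction (¬HasSquare⇒Squarefree {t = t} ¬sq) (no-squarefree-top t∈)

module Counting {s : ℕ} (A : OrderIdeal s) (pureA : Pure A) {m : ℕ} (3≤m : 3 ≤ m)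
                (maxDeg≡ : maxDeg A ≡ suc m) (h₂≤h₁ : countDeg A 2 ≤ countDeg A 1) where

  open TopShape A pureA 3≤m maxDeg≡ h₂≤h₁

  other-exponents≤1 : ∀ {t w k} → t ∈ Tops → m ≤ lookup t w → k ≢ w → lookup t k ≤ 1
  other-exponents≤1 {t} {w} {k} t∈ m≤tw k≢w = +-cancelˡ-≤ m (lookup t k) 1 (begin
    m + lookup t k               ≤⟨ +-monoˡ-≤ (lookup t k) m≤tw ⟩
    lookup t w + lookup t k      ≤⟨ lookup+lookup≤deg t (≢-sym k≢w) ⟩
    deg t                        ≡⟨ deg-top t∈ ⟩
    suc m                        ≡⟨ +-comm 1 m ⟩
    m + 1                        ∎)
    where open ≤-Reasoning

  lower : Monomial s → Monomial s
  lower t with any? (λ i → m ≤? lookup t i)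
  ... | yes (w , _) = t ÷ var w
  ... | no _ = t

  lower-spec : ∀ {t} → t ∈ Tops → ∃ λ w → m ≤ lookup t w × lower t ≡ t ÷ var w
  lower-spec {t} t∈ with any? (λ i → m ≤? lookup t i)
  ... | yes (w , m≤tw) = w , m≤tw , refl
  ... | no none = contradiction (top-shape t∈) none

  lower∈layer : ∀ {t} → t ∈ Tops → lower t ∈ layer A m
  lower∈layer {t} t∈ with lower-spec t∈
  ... | w , m≤tw , lower≡ = subst (_∈ layer A m) (sym lower≡)
    (∈-layer⁺ A (downward A (top∈ t∈) (÷∣ t (var w)))
                (suc-injective (trans (sym (deg-÷var {t = t} {w} 1≤tw)) (deg-top t∈))))
    where
    1≤tw : 1 ≤ lookup t w
    1≤tw = ≤-trans (s≤s z≤n) (≤-trans 3≤m m≤tw)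

  lower-injective : ∀ {t t′} → t ∈ Tops → t′ ∈ Tops → lower t ≡ lower t′ → t ≡ t′
  lower-injective {t} {t′} t∈ t′∈ lower≡lower′ with lower-spec t∈ | lower-spec t′∈
  ... | w , m≤tw , lower≡ | w′ , m≤t′w′ , lower≡′
    with trans (sym lower≡) (trans lower≡lower′ lower≡′) | w ≟ᶠ w′
  ...   | eq | yes refl = begin
    t                    ≡⟨ ∣⇒≡·÷ (⇒var∣ 1≤tw) ⟩
    var w · (t ÷ var w)  ≡⟨ cong (var w ·_) eq ⟩
    var w · (t′ ÷ var w) ≡⟨ ∣⇒≡·÷ (⇒var∣ (≤-trans (s≤s z≤n) (≤-trans 3≤m m≤t′w′))) ⟨
    t′                   ∎
    where
    open ≡-Reasoning
    1≤tw : 1 ≤ lookup t w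
    1≤tw = ≤-trans (s≤s z≤n) (≤-trans 3≤m m≤tw)
  ...   | eq | no w≢w′ = contradiction (begin
    2                      ≤⟨ ∸-monoˡ-≤ 1 (≤-trans 3≤m m≤tw) ⟩
    lookup t w ∸ 1         ≡⟨ lookup-÷var-self t w ⟨
    lookup (t ÷ var w) w   ≡⟨ cong (λ u → lookup u w) eq ⟩
    lookup (t′ ÷ var w′) w ≡⟨ lookup-÷var-other t′ (≢-sym w≢w′) ⟩
    lookup t′ w            ≤⟨ other-exponents≤1 t′∈ m≤t′w′ w≢w′ ⟩
    1                      ∎) λ { (s≤s ()) }
    where open ≤-Reasoning

  countDeg-top≤countDeg-below : countDeg A (suc m) ≤ countDeg A m
  countDeg-top≤countDeg-below = subst (_≤ countDeg A m) (length-map lower Tops)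
    (Unique-⊆⇒length≤ (Unique-map⁺-local lower lower-injective (Unique-layer A (suc m)))
      λ z∈ → let t , t∈ , z≡ = ∈-map⁻ lower z∈
             in subst (_∈ layer A m) (sym z≡) (lower∈layer t∈))

  length-supp-top≤2 : ∀ {t} → t ∈ Tops → length (supp t) ≤ 2
  length-supp-top≤2 {t} t∈ with top-shape t∈
  ... | w , m≤tw =
    ≤-trans (Unique-⊆⇒length≤ (Unique-supp t) supp⊆) (s≤s (≤-trans (length-supp≤deg rest) deg-rest≤1))
    where
    rest : Monomial s
    rest = t [ w ]≔ 0
    deg-rest≤1 : deg rest ≤ 1
    deg-rest≤1 = +-cancelˡ-≤ m (deg rest) 1 (begin
      m + deg rest            ≤⟨ +-monoˡ-≤ (deg rest) m≤tw ⟩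
      lookup t w + deg rest   ≡⟨ deg-[]≔0 t w ⟨
      deg t                   ≡⟨ deg-top t∈ ⟩
      suc m                   ≡⟨ +-comm 1 m ⟩
      m + 1                   ∎)
      where open ≤-Reasoning
    supp⊆ : ∀ {i} → i ∈ supp t → i ∈ w ∷ supp rest
    supp⊆ {i} i∈ with i ≟ᶠ w
    ... | yes refl = here refl
    ... | no i≢w =
      there (∈-supp⁺ rest (subst (1 ≤_) (sym (lookup∘update′ i≢w t 0)) (∈-supp⁻ t i∈)))

  lowerDivisors : Monomial s → List (Monomial s)
  lowerDivisors t = map (λ j → t ÷ var j) (supp t)

  layer-below⊆ : ∀ {u} → u ∈ layer A m → u ∈ concatMap lowerDivisors Tops
  layer-below⊆ {u} u∈ with ∈-layer⁻ A u∈
  ... | u∈A , deg-u with ∣-top u∈A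
  ...   | t , t∈ , u∣t with deg≡1⇒var {t = t ÷ u} deg-quotient
    where
    deg-quotient : deg (t ÷ u) ≡ 1
    deg-quotient = +-cancelˡ-≡ m (deg (t ÷ u)) 1 (begin
      m + deg (t ÷ u)          ≡⟨ cong (_+ deg (t ÷ u)) deg-u ⟨
      deg u + deg (t ÷ u)      ≡⟨ deg-· u (t ÷ u) ⟨
      deg (u · (t ÷ u))        ≡⟨ cong deg (∣⇒≡·÷ u∣t) ⟨
      deg t                    ≡⟨ deg-top t∈ ⟩
      suc m                    ≡⟨ +-comm 1 m ⟩
      m + 1                    ∎)
      where open ≡-Reasoning
  ...     | j , quotient≡ =
    ∈-concat⁺′ (subst (_∈ lowerDivisors t) u≡ (∈-map⁺ (λ j → t ÷ var j) j∈supp)) (∈-map⁺ lowerDivisors t∈)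
    where
    t≡ : t ≡ u · var j
    t≡ = trans (∣⇒≡·÷ u∣t) (cong (u ·_) quotient≡)
    j∈supp : j ∈ supp t
    j∈supp = ∈-supp⁺ t (var∣⇒ (subst (_∣ₘ t) quotient≡ (÷∣ t u)))
    u≡ : t ÷ var j ≡ u
    u≡ = trans (cong (_÷ var j) t≡) (·÷-cancelʳ u (var j))

  countDeg-below≤2*countDeg-top : countDeg A m ≤ 2 * countDeg A (suc m)
  countDeg-below≤2*countDeg-top = ≤-trans (Unique-⊆⇒length≤ (Unique-layer A m) layer-below⊆)
    (length-concatMap≤ lowerDivisors 2 Tops λ {t} t∈ →
      subst (_≤ 2) (sym (length-map (λ j → t ÷ var j) (supp t)))
      (length-supp-top≤2 t∈))

pureOSequence⇒bounds : ∀ {m a b} → 3 ≤ m → PureOSequence (1 ∷ replicate m a ++ b ∷ []) →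
                       b ≤ a × a ≤ 2 * b
pureOSequence⇒bounds {suc m′} {a} {b} 3≤m (_ , s , A , pureA , hVector≡)
  with Equivalence.to (hVector≡⇔ A (suc m′) a b) hVector≡
... | maxDeg≡ , inner , top =
  subst₂ _≤_ top below countDeg-top≤countDeg-below ,
  subst₂ (λ x y → x ≤ 2 * y) below top countDeg-below≤2*countDeg-top
  where
  below : countDeg A (suc m′) ≡ a
  below = inner m′ ≤-refl
  h₂≡h₁ : countDeg A 2 ≡ countDeg A 1
  h₂≡h₁ = trans (inner 1 (≤-trans (s≤s (s≤s z≤n)) 3≤m)) (sym (inner 0 (≤-trans (s≤s z≤n) 3≤m)))
  open Counting A pureA 3≤m maxDeg≡ (≤-reflexive h₂≡h₁)

theoremA : (n : ℕ) → 4 ≤ n → (a b : ℕ) → 0 < a → 0 < b →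
    PureOSequence (1 ∷ replicate (n ∸ 1) a ++ b ∷ []) ⇔ (b ≤ a × a ≤ 2 * b)
theoremA (suc m) (s≤s 3≤m) a b _ 0<b =
  mk⇔ (pureOSequence⇒bounds 3≤m) λ (b≤a , a≤2b) → bounds⇒pureOSequence m 0<b b≤a a≤2b
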